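{- Let $p$ be a prime and let $f(x)=\sum_{m=0}^{\infty}B_m\chi(m,x):\mathbb{Z}_p\to\mathbb{Z}_p$ be a measure-preserving 1-Lipschitz function in van der Put expansion. For $n\ge2$ and $p^{n-1}\le m\le p^n-1$ write $B_m=p^{n-1}b_m$ with $b_m=b_{m0}+b_{m1}p+\cdots$ ($0\le b_{mi}\le p-1$, $b_{m0}\ne0$) and set $T_n=\sum_{m=p^{n-1}}^{p^n-1}b_{m1}$. For $m\ge0$ write $f(m)=\sum_{i\ge0}f_{mi}p^i$ with $0\le f_{mi}\le p-1$, and for $n\ge1$ set $S_n=\sum_{m=0}^{p^n-1}f_{mn}$. Let $r$ be an integer. Then: (1) Case $n=2$. (a) If $p=2$: $\sum_{m=2}^{3}B_m\equiv4\pmod{2^3}\iff\sum_{m=2}^{3}b_m\equiv2\pmod{2^2}\iff S_2\equiv S_1\pmod2\iff T_2\equiv0\pmod2$; and $\sum_{m=2}^{3}B_m\equiv0\pmod{2^3}\iff\sum_{m=2}^{3}b_m\equiv0\pmod{2^2}\iff S_2\equiv S_1+1\pmod2\iff T_2\equiv1\pmod2$. (b) If $p>2$: $\sum_{m=p}^{p^2-1}B_m\equiv rp^2\pmod{p^3}\iff\sum_{m=p}^{p^2-1}b_m\equiv rp\pmod{p^2}\iff S_2\equiv S_1+r\pmod p\iff T_2\equiv r\pmod p$. (2) For $n\ge3$ and any prime $p$: $\sum_{m=p^{n-1}}^{p^n-1}B_m\equiv rp^n\pmod{p^{n+1}}\iff\sum_{m=p^{n-1}}^{p^n-1}b_m\equiv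 rp\pmod{p^2}\iff S_n\equiv S_{n-1}+r\pmod p\iff T_n\equiv r\pmod p$.
   Context: $\mathbb{Z}_p$ is the ring of $p$-adic integers with absolute value $|x|_p=p^{ -\mathrm{ord}(x)}$ and normalized Haar measure $\mu_p$. A function $f:\mathbb{Z}_p\to\mathbb{Z}_p$ is 1-Lipschitz if $|f(x)-f(y)|_p\le|x-y|_p$ for all $x,y$; measure-preserving if $\mu_p(f^{ -1}(S))=\mu_p(S)$ for every measurable $S$. For an integer $m>0$ with base-$p$ expansion $m=m_0+m_1p+\dots+m_sp^s$ ($0\le m_i\le p-1$, $m_s\ne0$), put $q(m)=m_sp^s$. The van der Put basis is: for $m>0$, $\chi(m,x)=1$ if $|x-m|_p\le p^{ -\lfloor\log_p m\rfloor-1}$ and $0$ otherwise; $\chi(0,x)=1$ if $|x|_p\le p^{ -1}$ and $0$ otherwise. Every continuous $f:\mathbb{Z}_p\to\mathbb{Z}_p$ has a unique expansion $f(x)=\sum_{m\ge0}B_m\chi(m,x)$ with $B_m\in\mathbb{Z}_p$, where $B_m=f(m)$ for $0\le m\le p-1$ and $B_m=f(m)-f(m-q(m))$ for $m\ge p$. For measure-preserving 1-Lipschitz $f$, $|B_m|_p=p^{ -(n-1)}$ when $p^{n-1}\le m\le p^n-1$, so $b_m$ is a unit. -}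

module Defs where

open import Data.Nat using (ℕ; zero; suc; _+_; _*_; _∸_; _^_; _<_; _<ᵇ_; _≡ᵇ_; NonZero)
open import Data.Nat.Properties using (m^n≢0)
open import Data.Nat.DivMod using (_/_; _mod_)
open import Data.Fin using (Fin; toℕ)
open import Data.Integer using (ℤ; +_) renaming (_*_ to _*ℤ_)
open import Data.Integer.DivMod using (_%ℕ_)
open import Data.Rational using (ℚ) renaming (_/_ to _/ℚ_)
open import Data.List using (List; map; foldr; applyUpTo; upTo; filterᵇ; length)
open import Data.Bool using (if_then_else_)
open import Data.Product using (_×_)
open import Relation.Binary.PropositionalEquality using (_≡_)

-- p-adic integers as digit streams: x = Σ_i (x i) p^i, 0 ≤ x i ≤ p-1.

ℤₚ : (p : ℕ) → Set
ℤₚ p = ℕ → Fin p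

module _ (p : ℕ) .{{_ : NonZero p}} where

  res : ℤₚ p → ℕ → ℕ
  res x zero    = 0
  res x (suc k) = res x k + toℕ (x k) * p ^ k

  -- the p-adic integer whose residue mod p^k is g k mod p^k
  -- (g must be a compatible family modulo p^k)
  fromRes : (ℕ → ℕ) → ℤₚ p
  fromRes g i = (_/_ (g (suc i)) (p ^ i) {{m^n≢0 p i}}) mod p

  ιℕ : ℕ → ℤₚ p
  ιℕ n = fromRes (λ _ → n)

  ιℤ : ℤ → ℤₚ p
  ιℤ r = fromRes (λ k → _%ℕ_ r (p ^ k) {{m^n≢0 p k}})

  _+ₚ_ : ℤₚ p → ℤₚ p → ℤₚ p
  x +ₚ y = fromRes (λ k → res x k + res y k)

  _-ₚ_ : ℤₚ p → ℤₚ p → ℤₚ p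
  x -ₚ y = fromRes (λ k → res x k + (p ^ k ∸ res y k))

  sumₚ : List (ℤₚ p) → ℤₚ p
  sumₚ = foldr _+ₚ_ (ιℕ 0)

  Cong : ℕ → ℤₚ p → ℤₚ p → Set
  Cong k x y = ∀ i → i < k → x i ≡ y i

  DivBy : ℕ → ℤₚ p → Set
  DivBy k x = ∀ i → i < k → toℕ (x i) ≡ 0

  -- 1-Lipschitz: |f x - f y|_p ≤ |x - y|_p, i.e.
  -- for all k, p^k ∣ x - y implies p^k ∣ f x - f y
  OneLipschitz : (ℤₚ p → ℤₚ p) → Set
  OneLipschitz f = ∀ x y k → DivBy k (x -ₚ y) → DivBy k (f x -ₚ f y)

  -- For a 1-Lipschitz f, the preimage of the ball a + p^k ℤₚ is a union of
  -- balls r + p^k ℤₚ (0 ≤ r < p^k); its Haar measure is (number of such r)/p^k.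
  preimageBallMeasure : (ℤₚ p → ℤₚ p) → ℕ → ℕ → ℚ
  preimageBallMeasure f k a =
    _/ℚ_ (+ length (filterᵇ (λ r → res (f (ιℕ r)) k ≡ᵇ a) (upTo (p ^ k))))
         (p ^ k) {{m^n≢0 p k}}

  -- measure-preserving: μ(f⁻¹(B)) = μ(B) for every ball B = a + p^k ℤₚ
  -- (balls form a generating π-system of the Borel σ-algebra)
  MeasurePreserving : (ℤₚ p → ℤₚ p) → Set
  MeasurePreserving f = ∀ k a → a < p ^ k →
    preimageBallMeasure f k a ≡ _/ℚ_ (+ 1) (p ^ k) {{m^n≢0 p k}}

  -- q(m) = m_s p^s, the leading term of the base-p expansion of m > 0.
  -- Computed with fuel (fuel = m suffices for p ≥ 2).
  qAux : ℕ → ℕ → ℕ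
  qAux zero    m = m
  qAux (suc t) m = if m <ᵇ p then m else p * qAux t (m / p)

  q : ℕ → ℕ
  q m = qAux m m

  B : (ℤₚ p → ℤₚ p) → ℕ → ℤₚ p
  B f m = if m <ᵇ p then f (ιℕ m) else (f (ιℕ m) -ₚ f (ιℕ (m ∸ q m)))

  -- b_m = B_m / p^{n-1} (for p^{n-1} ≤ m ≤ p^n - 1): shift digits by n-1
  b : (ℤₚ p → ℤₚ p) → ℕ → ℕ → ℤₚ p
  b f n m i = B f m (i + (n ∸ 1))

  block : ℕ → List ℕ
  block n = applyUpTo (λ j → p ^ (n ∸ 1) + j) (p ^ n ∸ p ^ (n ∸ 1))

  sumℕ : List ℕ → ℕ
  sumℕ = foldr _+_ 0

  ΣB : (ℤₚ p → ℤₚ p) → ℕ → ℤₚ p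
  ΣB f n = sumₚ (map (B f) (block n))

  Σb : (ℤₚ p → ℤₚ p) → ℕ → ℤₚ p
  Σb f n = sumₚ (map (b f n) (block n))

  T : (ℤₚ p → ℤₚ p) → ℕ → ℕ
  T f n = sumℕ (map (λ m → toℕ (b f n m 1)) (block n))

  S : (ℤₚ p → ℤₚ p) → ℕ → ℕ
  S f n = sumℕ (map (λ m → toℕ (f (ιℕ m) n)) (upTo (p ^ n)))

{-# OPTIONS --safe #-}
module Submission where

-- Put N = p^(n-1). Every m in the block p^(n-1) ≤ m < p^n is j + K N with j < N and 0 < K < p,
-- and q(m) = K N, so B_m = f(j + K N) - f(j). As f is 1-Lipschitz, f(j + K N) ≡ f(j) mod N, so
-- B_m = N b_m; as f is measure preserving, the digits f_{j+kN,n-1} (0 ≤ k < p) run through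
-- 0, …, p-1. Hence the digits b_{m0} ≡ f_{m,n-1} - f_{j,n-1} (mod p) of each fibre add up to
-- G = 0 + 1 + ⋯ + (p-1), so Σ b_m ≡ N G + p T_n (mod p²). Telescoping Σ B_m = Σ (f(j + K N) - f(j))
-- over the fibres instead gives Σ b_m ≡ N G + p (S_n - S_{n-1}) (mod p²), whence T_n ≡ S_n - S_{n-1}
-- (mod p). All the equivalences then follow once N G is known modulo p²: it vanishes unless
-- p = n = 2, where it equals 2.

open import Data.Nat as ℕ using (ℕ; zero; suc; _∸_; _^_; _<_; _≤_; _>_; _≥_; NonZero; z≤n; s≤s)
import Data.Nat.Properties as ℕP
import Data.Nat.Divisibility as ℕD
open import Data.Nat.DivMod using (_/_; _%_; m≡m%n+[m/n]*n)
import Data.Nat.DivMod as ℕDM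
open import Data.Nat.Primality using (Prime; prime⇒nonTrivial; prime⇒¬composite; composite)
open import Data.Nat.Tactic.RingSolver using () renaming (solve-∀ to ℕ-solve-∀)
open import Data.Integer as ℤ using (ℤ; +_; _+_; _*_; _-_; -_)
open import Data.Integer using () renaming (_+_ to _+ℤ_; _*_ to _*ℤ_)
import Data.Integer.Properties as ℤP
import Data.Integer.DivMod as ℤDM
open import Data.Integer.Divisibility using (_∣_)
import Data.Integer.Divisibility.Signed as Signed
open import Data.Integer.GCD using (gcd)
open import Data.Integer.Tactic.RingSolver using (solve-∀)
open import Data.Rational as ℚ using (↥_; ↧_; mkℚ)
import Data.Rational.Properties as ℚP
open import Data.Fin using (Fin; toℕ; fromℕ<; punchOut)
import Data.Fin.Properties as FinP
open import Data.Fin.Permutation using (permutation)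
open import Data.List using (List; []; _∷_; foldr; map; applyUpTo; upTo; length; filterᵇ)
import Data.List.Properties as ListP
open import Data.List.Membership.Propositional using (_∈_)
import Data.List.Membership.Propositional.Properties as MembershipP
open import Data.List.Relation.Unary.Any using (here)
open import Data.Bool as Bool using (Bool; true; false; if_then_else_)
open import Data.Product using (_×_; _,_; ∃; proj₁; proj₂)
open import Data.Sum using (_⊎_; inj₁; inj₂)
open import Data.Empty using (⊥-elim)
open import Function using (_∘_; id)
open import Function.Bundles using (_⇔_; mk⇔; module Equivalence)
open import Function.Definitions using (Injective)
open import Function.Properties.Equivalence using (⇔-setoid)
open import Level using (0ℓ)
open import Relation.Binary.Bundles using (Setoid)
import Relation.Binary.Reasoning.Setoid as SetoidReasoning
open import Relation.Binary.PropositionalEquality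
open import Relation.Nullary using (yes; no)
open import Relation.Nullary.Decidable using (T?)
import Algebra.Properties.CommutativeMonoid.Sum as MonoidSum

open import Defs

pos-∸ : ∀ {m n} → n ≤ m → + (m ∸ n) ≡ + m - + n
pos-∸ {m} {n} n≤m = sym (trans (ℤP.m-n≡m⊖n m n) (ℤP.⊖-≥ n≤m))

pos-+-* : ∀ a b c → + (a ℕ.+ b ℕ.* c) ≡ + a + + b * + c
pos-+-* a b c = trans (ℤP.pos-+ a (b ℕ.* c)) (cong (_+_ (+ a)) (ℤP.pos-* b c))

*-distribˡ-minus : ∀ c a b → c * (a - b) ≡ c * a - c * b
*-distribˡ-minus = solve-∀

infix 4 _≡_mod_
record _≡_mod_ (a b : ℤ) (M : ℕ) : Set where
  constructor mk≡mod
  field divides-difference : + M Signed.∣ a - b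

mod-refl : ∀ {a M} → a ≡ a mod M
mod-refl {a} = mk≡mod (Signed.divides (+ 0) (ℤP.+-inverseʳ a))

mod-reflexive : ∀ {a b M} → a ≡ b → a ≡ b mod M
mod-reflexive refl = mod-refl

mod-sym : ∀ {a b M} → a ≡ b mod M → b ≡ a mod M
mod-sym {a} {b} (mk≡mod d) = mk≡mod (subst (_ Signed.∣_) (negate a b) (Signed.∣m⇒∣-m d))
  where
  negate : ∀ a b → - (a - b) ≡ b - a
  negate = solve-∀

mod-trans : ∀ {a b c M} → a ≡ b mod M → b ≡ c mod M → a ≡ c mod M
mod-trans {a} {b} {c} (mk≡mod d₁) (mk≡mod d₂) = mk≡mod (subst (_ Signed.∣_) (telescope a b c) (Signed.∣m∣n⇒∣m+n d₁ d₂))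
  where
  telescope : ∀ a b c → (a - b) + (b - c) ≡ a - c
  telescope = solve-∀

+-cong-mod : ∀ {a b c d M} → a ≡ b mod M → c ≡ d mod M → a + c ≡ b + d mod M
+-cong-mod {a} {b} {c} {d} (mk≡mod d₁) (mk≡mod d₂) = mk≡mod (subst (_ Signed.∣_) (regroup a b c d) (Signed.∣m∣n⇒∣m+n d₁ d₂))
  where
  regroup : ∀ a b c d → (a - b) + (c - d) ≡ (a + c) - (b + d)
  regroup = solve-∀

neg-cong-mod : ∀ {a b M} → a ≡ b mod M → - a ≡ - b mod M
neg-cong-mod {a} {b} (mk≡mod d) = mk≡mod (subst (_ Signed.∣_) (negate a b) (Signed.∣m⇒∣-m d))
  where
  negate : ∀ a b → - (a - b) ≡ (- a) - (- b)
  negate = solve-∀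

minus-cong-mod : ∀ {a b c d M} → a ≡ b mod M → c ≡ d mod M → a - c ≡ b - d mod M
minus-cong-mod a≡b c≡d = +-cong-mod a≡b (neg-cong-mod c≡d)

mod-weaken : ∀ {a b M K} → K ℕD.∣ M → a ≡ b mod M → a ≡ b mod K
mod-weaken K∣M (mk≡mod d) = mk≡mod (Signed.∣-trans (Signed.∣ᵤ⇒∣ K∣M) d)

+-multiple-mod : ∀ a x M → a + x * + M ≡ a mod M
+-multiple-mod a x M = mk≡mod (Signed.divides x (cancel a x (+ M)))
  where
  cancel : ∀ a x m → (a + x * m) - a ≡ x * m
  cancel = solve-∀

*-cancelˡ-mod⇔ : ∀ c .{{_ : NonZero c}} {a b M} → (+ c * a ≡ + c * b mod c ℕ.* M) ⇔ (a ≡ b mod M)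
*-cancelˡ-mod⇔ c {a} {b} {M} = mk⇔
  (λ (mk≡mod d) → mk≡mod (Signed.*-cancelˡ-∣ (+ c) (subst₂ Signed._∣_ (ℤP.pos-* c M) (sym (*-distribˡ-minus (+ c) a b)) d)))
  (λ (mk≡mod d) → mk≡mod (subst₂ Signed._∣_ (sym (ℤP.pos-* c M)) (*-distribˡ-minus (+ c) a b) (Signed.*-monoʳ-∣ (+ c) d)))

+-cancelˡ-mod : ∀ {a b c M} → c + a ≡ c + b mod M → a ≡ b mod M
+-cancelˡ-mod {a} {b} {c} h = subst₂ (λ u v → u ≡ v mod _) (cancel a c) (cancel b c) (+-cong-mod h (mod-refl { - c}))
  where
  cancel : ∀ a c → (c + a) + (- c) ≡ a
  cancel = solve-∀

+-cancelʳ-mod : ∀ {a b c M} → a - c ≡ b - c mod M → a ≡ b mod M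
+-cancelʳ-mod {a} {b} {c} h = subst₂ (λ u v → u ≡ v mod _) (cancel a c) (cancel b c) (+-cong-mod h (mod-refl {c}))
  where
  cancel : ∀ a c → (a - c) + c ≡ a
  cancel = solve-∀

∣⇔≡0-mod : ∀ {x p} → (+ p ∣ x) ⇔ (x ≡ + 0 mod p)
∣⇔≡0-mod {x} {p} = mk⇔ (λ h → mk≡mod (Signed.∣ᵤ⇒∣ (subst (+ p ∣_) (sym (ℤP.+-identityʳ x)) h)))
                   (λ (mk≡mod d) → subst (+ p ∣_) (ℤP.+-identityʳ x) (Signed.∣⇒∣ᵤ d))

∣-cong-mod : ∀ {x y p} → x ≡ y mod p → (+ p ∣ x) ⇔ (+ p ∣ y)
∣-cong-mod x≡y = mk⇔ (λ h → from ∣⇔≡0-mod (mod-trans (mod-sym x≡y) (to ∣⇔≡0-mod h)))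
                     (λ h → from ∣⇔≡0-mod (mod-trans x≡y (to ∣⇔≡0-mod h)))
  where open Equivalence

mod⇔-≡0 : ∀ {a b M} → (a ≡ b mod M) ⇔ (a - b ≡ + 0 mod M)
mod⇔-≡0 {a} {b} = mk⇔ (λ h → subst (a - b ≡_mod _) (ℤP.+-inverseʳ b) (minus-cong-mod h (mod-refl {b})))
                      (λ h → subst₂ (λ u v → u ≡ v mod _) (cancel a b) (ℤP.+-identityˡ b) (+-cong-mod h (mod-refl {b})))
  where
  cancel : ∀ a b → (a - b) + b ≡ a
  cancel = solve-∀

mod-respˡ-⇔ : ∀ {a a′ c M} → a ≡ a′ mod M → (a ≡ c mod M) ⇔ (a′ ≡ c mod M)
mod-respˡ-⇔ a≡a′ = mk⇔ (mod-trans (mod-sym a≡a′)) (mod-trans a≡a′)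

mod-respʳ-⇔ : ∀ {a c c′ M} → c ≡ c′ mod M → (a ≡ c mod M) ⇔ (a ≡ c′ mod M)
mod-respʳ-⇔ c≡c′ = mk⇔ (λ h → mod-trans h c≡c′) (λ h → mod-trans h (mod-sym c≡c′))

mod-setoid : ℕ → Setoid 0ℓ 0ℓ
mod-setoid M = record
  { Carrier       = ℤ
  ; _≈_           = _≡_mod M
  ; isEquivalence = record { refl = mod-refl ; sym = mod-sym ; trans = mod-trans }
  }

module ModReasoning (M : ℕ) = SetoidReasoning (mod-setoid M)

≤-mod⇒≡ : ∀ {a b M} → a ≤ b → b < M → + b ≡ + a mod M → a ≡ b
≤-mod⇒≡ {a} {b} {M} a≤b b<M (mk≡mod d) with b ∸ a ℕ.≟ 0
... | yes b∸a≡0 = ℕP.≤-antisym a≤b (ℕP.m∸n≡0⇒m≤n b∸a≡0)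
... | no b∸a≢0 = ⊥-elim (ℕP.<⇒≱ (ℕP.≤-<-trans (ℕP.m∸n≤m b a) b<M) (ℕD.∣⇒≤ {{ℕ.≢-nonZero b∸a≢0}} M∣b∸a))
  where
  M∣b∸a : M ℕD.∣ (b ∸ a)
  M∣b∸a = subst (λ x → M ℕD.∣ ℤ.∣ x ∣) (sym (pos-∸ a≤b)) (Signed.∣⇒∣ᵤ d)

mod⇒≡ : ∀ {a b M} → a < M → b < M → + a ≡ + b mod M → a ≡ b
mod⇒≡ {a} {b} a<M b<M a≡b with ℕP.≤-total a b
... | inj₁ a≤b = ≤-mod⇒≡ a≤b b<M (mod-sym a≡b)
... | inj₂ b≤a = sym (≤-mod⇒≡ b≤a a<M a≡b)

%-mod : ∀ a M .{{_ : NonZero M}} → + (a % M) ≡ + a mod M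
%-mod a M = mod-sym (subst (_≡ + (a % M) mod M ) (sym a≡) (+-multiple-mod (+ (a % M)) (+ (a / M)) M))
  where
  a≡ : + a ≡ + (a % M) + + (a / M) * + M
  a≡ = begin
    + a                               ≡⟨ cong +_ (m≡m%n+[m/n]*n a M) ⟩
    + (a % M ℕ.+ a / M ℕ.* M)         ≡⟨ ℤP.pos-+ (a % M) _ ⟩
    + (a % M) + + (a / M ℕ.* M)       ≡⟨ cong (_+_ (+ (a % M))) (ℤP.pos-* (a / M) M) ⟩
    + (a % M) + + (a / M) * + M       ∎
    where open ≡-Reasoning

%ℕ-mod : ∀ z M .{{_ : NonZero M}} → + (z ℤDM.%ℕ M) ≡ z mod M
%ℕ-mod z M = mod-sym (subst (_≡ + (z ℤDM.%ℕ M) mod M ) (sym (ℤDM.a≡a%ℕn+[a/ℕn]*n z M))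
                            (+-multiple-mod (+ (z ℤDM.%ℕ M)) (z ℤDM./ℕ M) M))

%-split : ∀ a m n .{{_ : NonZero m}} .{{_ : NonZero n}} {{_ : NonZero (n ℕ.* m)}} →
          a % (n ℕ.* m) ≡ a % m ℕ.+ (a / m % n) ℕ.* m
%-split a m n = begin
  a % (n ℕ.* m)                                              ≡⟨ m≡m%n+[m/n]*n (a % (n ℕ.* m)) m ⟩
  a % (n ℕ.* m) % m ℕ.+ (a % (n ℕ.* m) / m) ℕ.* m            ≡⟨ cong₂ (λ u v → u ℕ.+ v ℕ.* m)
                                                                  (ℕDM.m∣n⇒o%n%m≡o%m m (n ℕ.* m) a (ℕD.n∣m*n n))
                                                                  (ℕDM.m%[n*o]/o≡m/o%n a n m) ⟩
  a % m ℕ.+ (a / m % n) ℕ.* m                                ∎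
  where open ≡-Reasoning

+∸-mod : ∀ a {c M} → c ≤ M → + (a ℕ.+ (M ∸ c)) ≡ + a - + c mod M
+∸-mod a {c} {M} c≤M = subst (_≡ + a - + c mod M ) (sym a+[M∸c]≡) (+-multiple-mod (+ a - + c) (+ 1) M)
  where
  shuffle : ∀ a M c → a + (M - c) ≡ (a - c) + + 1 * M
  shuffle = solve-∀
  a+[M∸c]≡ : + (a ℕ.+ (M ∸ c)) ≡ (+ a - + c) + + 1 * + M
  a+[M∸c]≡ = trans (ℤP.pos-+ a (M ∸ c)) (trans (cong (_+_ (+ a)) (pos-∸ c≤M)) (shuffle (+ a) (+ M) (+ c)))

∑ : ℕ → (ℕ → ℤ) → ℤ
∑ zero    g = + 0
∑ (suc n) g = g 0 + ∑ n (g ∘ suc)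

infix 5 ∑
syntax ∑ n (λ i → e) = ∑[ i < n ] e

∑-cong : ∀ n {g h} → (∀ i → i < n → g i ≡ h i) → ∑ n g ≡ ∑ n h
∑-cong zero    g≡h = refl
∑-cong (suc n) g≡h = cong₂ _+_ (g≡h 0 (s≤s z≤n)) (∑-cong n (λ i i<n → g≡h (suc i) (s≤s i<n)))

∑-cong-mod : ∀ n {g h M} → (∀ i → i < n → g i ≡ h i mod M) → ∑ n g ≡ ∑ n h mod M
∑-cong-mod zero    g≡h = mod-refl
∑-cong-mod (suc n) g≡h = +-cong-mod (g≡h 0 (s≤s z≤n)) (∑-cong-mod n (λ i i<n → g≡h (suc i) (s≤s i<n)))

∑-distrib-+ : ∀ n g h → ∑[ i < n ] (g i + h i) ≡ ∑ n g + ∑ n h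
∑-distrib-+ zero    g h = refl
∑-distrib-+ (suc n) g h = trans (cong (_+_ (g 0 + h 0)) (∑-distrib-+ n (g ∘ suc) (h ∘ suc)))
                                (regroup (g 0) (h 0) (∑ n (g ∘ suc)) (∑ n (h ∘ suc)))
  where
  regroup : ∀ a b c d → (a + b) + (c + d) ≡ (a + c) + (b + d)
  regroup = solve-∀

∑-distribˡ-* : ∀ n c g → ∑[ i < n ] (c * g i) ≡ c * ∑ n g
∑-distribˡ-* zero    c g = sym (ℤP.*-zeroʳ c)
∑-distribˡ-* (suc n) c g = trans (cong (_+_ (c * g 0)) (∑-distribˡ-* n c (g ∘ suc))) (sym (ℤP.*-distribˡ-+ c (g 0) _))

∑-const : ∀ n c → ∑[ i < n ] c ≡ + n * c
∑-const zero    c = sym (ℤP.*-zeroˡ c)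
∑-const (suc n) c = trans (cong (_+_ c) (∑-const n c)) (sym (ℤP.suc-* (+ n) c))

∑-affine : ∀ n a b c (u v : ℕ → ℤ) → ∑[ i < n ] (a + b * u i + c * v i) ≡ + n * a + b * ∑ n u + c * ∑ n v
∑-affine zero    a b c u v = collapse a b c
  where
  collapse : ∀ a b c → + 0 ≡ + 0 * a + b * + 0 + c * + 0
  collapse = solve-∀
∑-affine (suc n) a b c u v = trans (cong (_+_ (a + b * u 0 + c * v 0)) (∑-affine n a b c (u ∘ suc) (v ∘ suc)))
                                   (regroup a b c (u 0) (v 0) (+ n) (∑ n (u ∘ suc)) (∑ n (v ∘ suc)))
  where
  regroup : ∀ a b c u₀ v₀ n U V → (a + b * u₀ + c * v₀) + (n * a + b * U + c * V) ≡ (+ 1 + n) * a + b * (u₀ + U) + c * (v₀ + V)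
  regroup = solve-∀

∑-split : ∀ m n g → ∑ (m ℕ.+ n) g ≡ ∑ m g + (∑[ i < n ] g (m ℕ.+ i))
∑-split zero    n g = sym (ℤP.+-identityˡ _)
∑-split (suc m) n g = trans (cong (_+_ (g 0)) (∑-split m n (g ∘ suc))) (sym (ℤP.+-assoc (g 0) _ _))

∑-product : ∀ m n g → ∑ (m ℕ.* n) g ≡ ∑[ i < m ] ∑[ j < n ] g (i ℕ.* n ℕ.+ j)
∑-product zero    n g = refl
∑-product (suc m) n g = trans (∑-split n (m ℕ.* n) g) (cong (_+_ (∑ n g))
  (trans (∑-product m n (λ i → g (n ℕ.+ i)))
         (∑-cong m (λ i _ → ∑-cong n (λ j _ → cong g (sym (ℕP.+-assoc n (i ℕ.* n) j)))))))

∑-comm : ∀ m n (g : ℕ → ℕ → ℤ) → ∑[ i < m ] ∑[ j < n ] g i j ≡ ∑[ j < n ] ∑[ i < m ] g i j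
∑-comm zero    n g = sym (trans (∑-const n (+ 0)) (ℤP.*-zeroʳ (+ n)))
∑-comm (suc m) n g = trans (cong (_+_ (∑ n (g 0))) (∑-comm m n (g ∘ suc)))
                           (sym (∑-distrib-+ n (g 0) (λ j → (∑[ i < m ] g (suc i) j))))

sumℤ : List ℤ → ℤ
sumℤ = foldr _+_ (+ 0)

sumℤ-applyUpTo : ∀ {A : Set} (g : A → ℤ) h n → sumℤ (map g (applyUpTo h n)) ≡ ∑[ i < n ] g (h i)
sumℤ-applyUpTo g h zero    = refl
sumℤ-applyUpTo g h (suc n) = cong (_+_ (g (h 0))) (sumℤ-applyUpTo g (h ∘ suc) n)

pos-foldr-+ : ∀ {A : Set} (g : A → ℕ) L → + foldr ℕ._+_ 0 (map g L) ≡ sumℤ (map (λ k → + g k) L)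
pos-foldr-+ g []      = refl
pos-foldr-+ g (x ∷ L) = trans (ℤP.pos-+ (g x) _) (cong (_+_ (+ g x)) (pos-foldr-+ g L))

injective⇒surjective : ∀ {n} (g : Fin n → Fin n) → Injective _≡_ _≡_ g → ∀ v → ∃ λ i → g i ≡ v
injective⇒surjective {suc n} g g-inj v with FinP.any? (λ i → g i FinP.≟ v)
... | yes v∈img = v∈img
... | no  v∉img = ⊥-elim (FinP.<⇒notInjective (ℕP.n<1+n n) squeeze-injective)
  where
  v≢g : ∀ i → v ≢ g i
  v≢g i v≡gi = v∉img (i , sym v≡gi)
  squeeze : Fin (suc n) → Fin n
  squeeze i = punchOut (v≢g i)
  squeeze-injective : Injective _≡_ _≡_ squeeze
  squeeze-injective {i} {j} eq = g-inj (FinP.punchOut-injective (v≢g i) (v≢g j) eq)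

open MonoidSum ℤP.+-0-commutativeMonoid using (sum; sum-cong-≗; sum-permute)

sum≡∑ : ∀ n (g : ℕ → ℤ) → sum {n} (g ∘ toℕ) ≡ ∑ n g
sum≡∑ zero    g = refl
sum≡∑ (suc n) g = cong (_+_ (g 0)) (sum≡∑ n (g ∘ suc))

∑-permute : ∀ n (g : ℕ → ℕ) → (∀ k → k < n → g k < n) → (∀ i j → i < n → j < n → g i ≡ g j → i ≡ j) →
            ∑[ k < n ] + g k ≡ ∑[ k < n ] + k
∑-permute n g g< g-inj = begin
  ∑[ k < n ] + g k           ≡⟨ sym (sum≡∑ n (λ k → + g k)) ⟩
  sum {n} (λ i → + g (toℕ i))    ≡⟨ sum-cong-≗ (λ i → cong +_ (sym (FinP.toℕ-fromℕ< (g< (toℕ i) (FinP.toℕ<n i))))) ⟩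
  sum {n} (λ i → + toℕ (G i))    ≡⟨ sym (sum-permute (λ i → + toℕ i) π) ⟩
  sum {n} (λ i → + toℕ i)        ≡⟨ sum≡∑ n (λ k → + k) ⟩
  ∑[ k < n ] + k             ∎
  where
  open ≡-Reasoning
  G : Fin n → Fin n
  G i = fromℕ< (g< (toℕ i) (FinP.toℕ<n i))
  G-inj : Injective _≡_ _≡_ G
  G-inj {i} {j} eq = FinP.toℕ-injective (g-inj (toℕ i) (toℕ j) (FinP.toℕ<n i) (FinP.toℕ<n j)
    (trans (sym (FinP.toℕ-fromℕ< _)) (trans (cong toℕ eq) (FinP.toℕ-fromℕ< _))))
  G⁻¹ : Fin n → Fin n
  G⁻¹ v = proj₁ (injective⇒surjective G G-inj v)
  π = permutation G G⁻¹ (λ v → proj₂ (injective⇒surjective G G-inj v))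
                        (λ i → G-inj (proj₂ (injective⇒surjective G G-inj (G i))))

∑-range-double : ∀ n c → + 2 * (∑[ i < n ] (c + + i)) ≡ + n * (+ 2 * c + + n - + 1)
∑-range-double zero    c = sym (ℤP.*-zeroˡ (+ 2 * c + + 0 - + 1))
∑-range-double (suc n) c = begin
  + 2 * (c + + 0 + (∑[ i < n ] (c + + suc i)))
    ≡⟨ cong (λ s → + 2 * (c + + 0 + s)) (∑-cong n (λ i _ → sym (ℤP.+-assoc c (+ 1) (+ i)))) ⟩
  + 2 * (c + + 0 + (∑[ i < n ] (c + + 1 + + i)))
    ≡⟨ ℤP.*-distribˡ-+ (+ 2) (c + + 0) _ ⟩
  + 2 * (c + + 0) + + 2 * (∑[ i < n ] (c + + 1 + + i))
    ≡⟨ cong (_+_ (+ 2 * (c + + 0))) (∑-range-double n (c + + 1)) ⟩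
  + 2 * (c + + 0) + + n * (+ 2 * (c + + 1) + + n - + 1)
    ≡⟨ gauss-step c (+ n) ⟩
  (+ 1 + + n) * (+ 2 * c + (+ 1 + + n) - + 1) ∎
  where
  open ≡-Reasoning
  gauss-step : ∀ c n → + 2 * (c + + 0) + n * (+ 2 * (c + + 1) + n - + 1) ≡ (+ 1 + n) * (+ 2 * c + (+ 1 + n) - + 1)
  gauss-step = solve-∀

-- Residues of p-adic digit streams

module _ (p : ℕ) .{{_ : NonZero p}} where

  infixl 7 _/p^_ _%p^_
  _/p^_ _%p^_ : ℕ → ℕ → ℕ
  a /p^ k = _/_ a (p ^ k) {{ℕP.m^n≢0 p k}}
  a %p^ k = _%_ a (p ^ k) {{ℕP.m^n≢0 p k}}

  %p^-mod : ∀ a k → + (a %p^ k) ≡ + a mod p ^ k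
  %p^-mod a k = %-mod a (p ^ k) {{ℕP.m^n≢0 p k}}

  res<p^ : ∀ x k → res p x k < p ^ k
  res<p^ x zero    = s≤s z≤n
  res<p^ x (suc k) = ℕP.<-≤-trans (ℕP.+-monoˡ-< (toℕ (x k) ℕ.* p ^ k) (res<p^ x k))
                                  (ℕP.*-monoˡ-≤ (p ^ k) (FinP.toℕ<n (x k)))

  res-+ : ∀ x a j → res p x (a ℕ.+ j) ≡ res p x a ℕ.+ p ^ a ℕ.* res p (λ i → x (i ℕ.+ a)) j
  res-+ x a zero    = trans (cong (res p x) (ℕP.+-identityʳ a))
                            (sym (trans (cong (res p x a ℕ.+_) (ℕP.*-zeroʳ (p ^ a))) (ℕP.+-identityʳ _)))
  res-+ x a (suc j) rewrite ℕP.+-suc a j | res-+ x a j | ℕP.+-comm j a | ℕP.^-distribˡ-+-* p a j =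
    regroup (res p x a) (p ^ a) (res p (λ i → x (i ℕ.+ a)) j) (toℕ (x (a ℕ.+ j))) (p ^ j)
    where
    regroup : ∀ r P s d Q → r ℕ.+ P ℕ.* s ℕ.+ d ℕ.* (P ℕ.* Q) ≡ r ℕ.+ P ℕ.* (s ℕ.+ d ℕ.* Q)
    regroup = ℕ-solve-∀

  digit≡res : ∀ x {i k} → i < k → toℕ (x i) ≡ res p x k /p^ i % p
  digit≡res x {i} {k} i<k = sym (begin
    (res p x k / p ^ i) % p
      ≡⟨ cong (λ r → (r / p ^ i) % p) (trans (cong (res p x) (sym (ℕP.m+[n∸m]≡n i<k))) (res-+ x (suc i) _)) ⟩
    ((res p x i ℕ.+ d ℕ.* p ^ i ℕ.+ p ^ suc i ℕ.* higher) / p ^ i) % p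
      ≡⟨ cong (λ r → (r / p ^ i) % p) (regroup (res p x i) d (p ^ i) p higher) ⟩
    ((res p x i ℕ.+ (d ℕ.+ higher ℕ.* p) ℕ.* p ^ i) / p ^ i) % p
      ≡⟨ cong (_% p) (ℕDM.+-distrib-/-∣ʳ (res p x i) {d = p ^ i} (ℕD.n∣m*n (d ℕ.+ higher ℕ.* p))) ⟩
    (res p x i / p ^ i ℕ.+ (d ℕ.+ higher ℕ.* p) ℕ.* p ^ i / p ^ i) % p
      ≡⟨ cong₂ (λ u v → (u ℕ.+ v) % p) (ℕDM.m<n⇒m/n≡0 (res<p^ x i)) (ℕDM.m*n/n≡m (d ℕ.+ higher ℕ.* p) (p ^ i)) ⟩
    (d ℕ.+ higher ℕ.* p) % p
      ≡⟨ ℕDM.[m+kn]%n≡m%n d higher p ⟩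
    d % p
      ≡⟨ ℕDM.m<n⇒m%n≡m (FinP.toℕ<n (x i)) ⟩
    d ∎)
    where
    open ≡-Reasoning
    d = toℕ (x i)
    higher = res p (λ j → x (j ℕ.+ suc i)) (k ∸ suc i)
    instance _ = ℕP.m^n≢0 p i
    regroup : ∀ r d P p h → r ℕ.+ d ℕ.* P ℕ.+ p ℕ.* P ℕ.* h ≡ r ℕ.+ (d ℕ.+ h ℕ.* p) ℕ.* P
    regroup = ℕ-solve-∀

  Cong⇔res≡ : ∀ k x y → Cong p k x y ⇔ (res p x k ≡ res p y k)
  Cong⇔res≡ k x y = mk⇔ (to k) from
    where
    to : ∀ k → Cong p k x y → res p x k ≡ res p y k
    to zero    x≡y = refl
    to (suc k) x≡y = cong₂ (λ r d → r ℕ.+ toℕ d ℕ.* p ^ k)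
                           (to k (λ i i<k → x≡y i (ℕP.m<n⇒m<1+n i<k))) (x≡y k ℕP.≤-refl)
    from : res p x k ≡ res p y k → Cong p k x y
    from eq i i<k = FinP.toℕ-injective
      (trans (digit≡res x i<k) (trans (cong (λ r → r /p^ i % p) eq) (sym (digit≡res y i<k))))

  DivBy⇔res≡0 : ∀ k x → DivBy p k x ⇔ (res p x k ≡ 0)
  DivBy⇔res≡0 k x = mk⇔ (to k) from
    where
    to : ∀ k → DivBy p k x → res p x k ≡ 0
    to zero    _     = refl
    to (suc k) x≡0 rewrite to k (λ i i<k → x≡0 i (ℕP.m<n⇒m<1+n i<k)) | x≡0 k ℕP.≤-refl = refl
    from : res p x k ≡ 0 → DivBy p k x
    from eq i i<k = begin
      toℕ (x i)                ≡⟨ digit≡res x i<k ⟩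
      (res p x k / p ^ i) % p  ≡⟨ cong (λ r → (r / p ^ i) % p) eq ⟩
      (0 / p ^ i) % p          ≡⟨ cong (_% p) (ℕDM.0/n≡0 (p ^ i)) ⟩
      0 % p                    ≡⟨ ℕDM.m<n⇒m%n≡m (ℕ.>-nonZero⁻¹ p) ⟩
      0                        ∎
      where
      open ≡-Reasoning
      instance _ = ℕP.m^n≢0 p i

  res-suc-mod : ∀ x k → + res p x (suc k) ≡ + res p x k mod p ^ k
  res-suc-mod x k = subst (_≡ + res p x k mod p ^ k) (sym res-suc≡)
                          (+-multiple-mod (+ res p x k) (+ toℕ (x k)) (p ^ k))
    where
    res-suc≡ : + res p x (suc k) ≡ + res p x k + + toℕ (x k) * + p ^ k
    res-suc≡ = pos-+-* (res p x k) (toℕ (x k)) (p ^ k)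

  res-fromRes≡% : ∀ g → (∀ k → g (suc k) %p^ k ≡ g k %p^ k) → ∀ k → res p (fromRes p g) k ≡ g k %p^ k
  res-fromRes≡% g compatible zero    = sym (ℕDM.n%1≡0 (g 0))
  res-fromRes≡% g compatible (suc k) = begin
    res p (fromRes p g) k ℕ.+ toℕ ((g (suc k) / p ^ k) ℕDM.mod p) ℕ.* p ^ k
      ≡⟨ cong₂ (λ u v → u ℕ.+ v ℕ.* p ^ k) (trans (res-fromRes≡% g compatible k) (sym (compatible k)))
                                          (FinP.toℕ-fromℕ< {m = g (suc k) /p^ k % p} _) ⟩
    g (suc k) % p ^ k ℕ.+ (g (suc k) / p ^ k % p) ℕ.* p ^ k
      ≡⟨ sym (%-split (g (suc k)) (p ^ k) p) ⟩
    g (suc k) % p ^ suc k ∎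
    where
    open ≡-Reasoning
    instance
      _ = ℕP.m^n≢0 p k
      _ = ℕP.m^n≢0 p (suc k)

  res-fromRes : ∀ g (G : ℕ → ℤ) → (∀ k → + g k ≡ G k mod p ^ k) → (∀ k → G (suc k) ≡ G k mod p ^ k) →
                ∀ k → + res p (fromRes p g) k ≡ G k mod p ^ k
  res-fromRes g G g≡G G-compatible k =
    subst (_≡ G k mod p ^ k) (cong +_ (sym (res-fromRes≡% g compatible k))) (mod-trans (%p^-mod (g k) k) (g≡G k))
    where
    g-compatible : ∀ k → + g (suc k) ≡ + g k mod p ^ k
    g-compatible k = mod-trans (mod-weaken (ℕD.n∣m*n p) (g≡G (suc k))) (mod-trans (G-compatible k) (mod-sym (g≡G k)))
    compatible : ∀ k → g (suc k) %p^ k ≡ g k %p^ k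
    compatible k = mod⇒≡ (ℕDM.m%n<n _ (p ^ k) {{ℕP.m^n≢0 p k}}) (ℕDM.m%n<n _ (p ^ k) {{ℕP.m^n≢0 p k}})
      (mod-trans (%p^-mod (g (suc k)) k) (mod-trans (g-compatible k) (mod-sym (%p^-mod (g k) k))))

  res-ιℕ : ∀ c k → + res p (ιℕ p c) k ≡ + c mod p ^ k
  res-ιℕ c = res-fromRes (λ _ → c) (λ _ → + c) (λ _ → mod-refl) (λ _ → mod-refl)

  res-ιℤ : ∀ z k → + res p (ιℤ p z) k ≡ z mod p ^ k
  res-ιℤ z = res-fromRes _ (λ _ → z) (λ k → %ℕ-mod z (p ^ k) {{ℕP.m^n≢0 p k}}) (λ _ → mod-refl)

  res-+ₚ : ∀ x y k → + res p (_+ₚ_ p x y) k ≡ + res p x k + + res p y k mod p ^ k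
  res-+ₚ x y = res-fromRes _ (λ k → + res p x k + + res p y k)
    (λ k → mod-reflexive (ℤP.pos-+ (res p x k) (res p y k)))
    (λ k → +-cong-mod (res-suc-mod x k) (res-suc-mod y k))

  res--ₚ : ∀ x y k → + res p (_-ₚ_ p x y) k ≡ + res p x k - + res p y k mod p ^ k
  res--ₚ x y = res-fromRes _ (λ k → + res p x k - + res p y k)
    (λ k → +∸-mod (res p x k) (ℕP.<⇒≤ (res<p^ y k)))
    (λ k → minus-cong-mod (res-suc-mod x k) (res-suc-mod y k))

  res--ₚ≡0⇒res≡ : ∀ x y k → res p (_-ₚ_ p x y) k ≡ 0 → res p x k ≡ res p y k
  res--ₚ≡0⇒res≡ x y k eq = mod⇒≡ (res<p^ x k) (res<p^ y k) (from mod⇔-≡0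
    (mod-trans (mod-sym (res--ₚ x y k)) (mod-reflexive (cong +_ eq))))
    where open Equivalence

  Cong⇔mod : ∀ k x y {z} → + res p y k ≡ z mod p ^ k → Cong p k x y ⇔ (+ res p x k ≡ z mod p ^ k)
  Cong⇔mod k x y y≡z = mk⇔
    (λ x≡y → mod-trans (mod-reflexive (cong +_ (to (Cong⇔res≡ k x y) x≡y))) y≡z)
    (λ x≡z → from (Cong⇔res≡ k x y) (mod⇒≡ (res<p^ x k) (res<p^ y k) (mod-trans x≡z (mod-sym y≡z))))
    where open Equivalence

  res-2 : ∀ x → + res p x 2 ≡ + toℕ (x 0) + + p * + toℕ (x 1)
  res-2 x = trans (cong +_ (shape (toℕ (x 0)) (toℕ (x 1)) p)) (pos-+-* (toℕ (x 0)) p (toℕ (x 1)))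
    where
    shape : ∀ a c p → 0 ℕ.+ a ℕ.* 1 ℕ.+ c ℕ.* (p ℕ.* 1) ≡ a ℕ.+ p ℕ.* c
    shape = ℕ-solve-∀

  res-sumₚ : ∀ xs k → + res p (sumₚ p xs) k ≡ sumℤ (map (λ x → + res p x k) xs) mod p ^ k
  res-sumₚ []       k = res-ιℕ 0 k
  res-sumₚ (x ∷ xs) k = mod-trans (res-+ₚ x (sumₚ p xs) k) (+-cong-mod (mod-refl {+ res p x k}) (res-sumₚ xs k))

if-<ᵇ-yes : ∀ {A : Set} {m n} (x y : A) → m < n → (if m ℕ.<ᵇ n then x else y) ≡ x
if-<ᵇ-yes {m = m} {n} x y m<n with m ℕ.<ᵇ n in eq
... | true  = refl
... | false = ⊥-elim (subst Bool.T eq (ℕP.<⇒<ᵇ m<n))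

if-<ᵇ-no : ∀ {A : Set} {m n} (x y : A) → n ≤ m → (if m ℕ.<ᵇ n then x else y) ≡ y
if-<ᵇ-no {m = m} {n} x y n≤m with m ℕ.<ᵇ n in eq
... | true  = ⊥-elim (ℕP.<⇒≱ (ℕP.<ᵇ⇒< m n (subst Bool.T (sym eq) _)) n≤m)
... | false = refl

module _ (p : ℕ) .{{_ : NonZero p}} where

  n<p^n : 1 < p → ∀ n → n < p ^ n
  n<p^n p>1 zero    = s≤s z≤n
  n<p^n p>1 (suc n) = begin-strict
    suc n        ≤⟨ n<p^n p>1 n ⟩
    p ^ n        <⟨ ℕP.m<m*n (p ^ n) p p>1 ⟩
    p ^ n ℕ.* p  ≡⟨ ℕP.*-comm (p ^ n) p ⟩
    p ^ suc n    ∎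
    where
    open ℕP.≤-Reasoning
    instance _ = ℕP.m^n≢0 p n

  qAux-leading : ∀ s t j K → j < p ^ s → 1 ≤ K → K < p → s ≤ t → qAux p t (j ℕ.+ K ℕ.* p ^ s) ≡ K ℕ.* p ^ s
  qAux-leading zero t zero K _ _ K<p _ with t
  ... | zero   = refl
  ... | suc _  = if-<ᵇ-yes _ _ (subst (_< p) (sym (ℕP.*-identityʳ K)) K<p)
  qAux-leading zero t (suc j) K (s≤s ()) _ _ _
  qAux-leading (suc s) (suc t) j K j<p^s+1 K≥1 K<p (s≤s s≤t) = begin
    qAux p (suc t) m                          ≡⟨ if-<ᵇ-no _ _ p≤m ⟩
    p ℕ.* qAux p t (m / p)                    ≡⟨ cong (λ r → p ℕ.* qAux p t r) m/p≡ ⟩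
    p ℕ.* qAux p t (j / p ℕ.+ K ℕ.* p ^ s)    ≡⟨ cong (p ℕ.*_) (qAux-leading s t (j / p) K j/p<p^s K≥1 K<p s≤t) ⟩
    p ℕ.* (K ℕ.* p ^ s)                       ≡⟨ ℕP.*-comm p (K ℕ.* p ^ s) ⟩
    K ℕ.* p ^ s ℕ.* p                         ≡⟨ ℕP.*-assoc K (p ^ s) p ⟩
    K ℕ.* (p ^ s ℕ.* p)                       ≡⟨ cong (K ℕ.*_) (ℕP.*-comm (p ^ s) p) ⟩
    K ℕ.* p ^ suc s                           ∎
    where
    open ≡-Reasoning
    instance _ = ℕP.m^n≢0 p s
    m = j ℕ.+ K ℕ.* p ^ suc s
    p≤m : p ≤ m
    p≤m = ℕP.≤-trans (ℕP.m≤m*n p (p ^ s)) (ℕP.≤-trans (ℕP.m≤n*m (p ^ suc s) K {{ℕ.>-nonZero K≥1}}) (ℕP.m≤n+m _ j))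
    K*p^s*p≡ : K ℕ.* p ^ suc s ≡ K ℕ.* p ^ s ℕ.* p
    K*p^s*p≡ = trans (cong (K ℕ.*_) (ℕP.*-comm p (p ^ s))) (sym (ℕP.*-assoc K (p ^ s) p))
    m/p≡ : m / p ≡ j / p ℕ.+ K ℕ.* p ^ s
    m/p≡ = trans (ℕDM.+-distrib-/-∣ʳ j (ℕD.divides (K ℕ.* p ^ s) K*p^s*p≡))
                 (cong (j / p ℕ.+_) (trans (cong (_/ p) K*p^s*p≡) (ℕDM.m*n/n≡m (K ℕ.* p ^ s) p)))
    j/p<p^s : j / p < p ^ s
    j/p<p^s = ℕDM.m<n*o⇒m/o<n (subst (j <_) (ℕP.*-comm p (p ^ s)) j<p^s+1)

  q-leading : 1 < p → ∀ s j K → j < p ^ s → 1 ≤ K → K < p → q p (j ℕ.+ K ℕ.* p ^ s) ≡ K ℕ.* p ^ s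
  q-leading p>1 s j K j<p^s K≥1 K<p = qAux-leading s _ j K j<p^s K≥1 K<p
    (ℕP.≤-trans (ℕP.<⇒≤ (n<p^n p>1 s)) (ℕP.≤-trans (ℕP.m≤n*m (p ^ s) K {{ℕ.>-nonZero K≥1}}) (ℕP.m≤n+m _ j)))

-- Measure preservation makes f injective on residues

pos/-injective : ∀ a b P .{{_ : NonZero P}} → (+ a) ℚ./ P ≡ (+ b) ℚ./ P → a ≡ b
pos/-injective a b P eq = ℤP.+-injective (begin
  + a                                  ≡⟨ sym (ℚP.↥-/ (+ a) P) ⟩
  ↥ ((+ a) ℚ./ P) * gcd (+ a) (+ P)    ≡⟨ cong₂ _*_ (cong ↥_ eq) gcd≡ ⟩
  ↥ ((+ b) ℚ./ P) * gcd (+ b) (+ P)    ≡⟨ ℚP.↥-/ (+ b) P ⟩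
  + b                                  ∎)
  where
  open ≡-Reasoning
  ↧-nonZero : ∀ q → ℤ.NonZero (↧ q)
  ↧-nonZero (mkℚ _ _ _) = _
  gcd≡ : gcd (+ a) (+ P) ≡ gcd (+ b) (+ P)
  gcd≡ = ℤP.*-cancelˡ-≡ (↧ ((+ b) ℚ./ P)) _ _ {{↧-nonZero ((+ b) ℚ./ P)}}
    (trans (cong (_* gcd (+ a) (+ P)) (cong ↧_ (sym eq))) (trans (ℚP.↧-/ (+ a) P) (sym (ℚP.↧-/ (+ b) P))))

length≡1⇒∈-unique : ∀ {A : Set} (xs : List A) {a b} → length xs ≡ 1 → a ∈ xs → b ∈ xs → a ≡ b
length≡1⇒∈-unique (x ∷ []) _ (here refl) (here refl) = refl

measurePreserving⇒res-injective : ∀ {p} .{{_ : NonZero p}} {f} → MeasurePreserving p f → ∀ k {m₁ m₂} →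
  m₁ < p ^ k → m₂ < p ^ k → res p (f (ιℕ p m₁)) k ≡ res p (f (ιℕ p m₂)) k → m₁ ≡ m₂
measurePreserving⇒res-injective {p} {f} mp k {m₁} {m₂} m₁<p^k m₂<p^k eq =
  length≡1⇒∈-unique preimage
    (pos/-injective _ 1 (p ^ k) {{ℕP.m^n≢0 p k}} (mp k a (res<p^ p (f (ιℕ p m₁)) k)))
    (MembershipP.∈-filter⁺ (T? ∘ hits) (MembershipP.∈-upTo⁺ m₁<p^k) (ℕP.≡⇒≡ᵇ a a refl))
    (MembershipP.∈-filter⁺ (T? ∘ hits) (MembershipP.∈-upTo⁺ m₂<p^k) (ℕP.≡⇒≡ᵇ _ a (sym eq)))
  where
  a = res p (f (ιℕ p m₁)) k
  hits : ℕ → Bool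
  hits r = res p (f (ιℕ p r)) k ℕ.≡ᵇ a
  preimage = filterᵇ hits (upTo (p ^ k))

CongruenceChain : (p : ℕ) .{{_ : NonZero p}} → (ℤₚ p → ℤₚ p) → ℕ → ℤ → Set
CongruenceChain p f n r =
  (Cong p (suc n) (ΣB p f n) (ιℤ p (r * + (p ^ n))) ⇔ Cong p 2 (Σb p f n) (ιℤ p (r * + p)))
  × (Cong p 2 (Σb p f n) (ιℤ p (r * + p)) ⇔ + p ∣ (+ S p f n - (+ S p f (n ∸ 1) + r)))
  × (+ p ∣ (+ S p f n - (+ S p f (n ∸ 1) + r)) ⇔ + p ∣ (+ T p f n - r))

-- The block p^(n-1) ≤ m < p^n of van der Put coefficients

module VanDerPutBlock (p : ℕ) .{{_ : NonZero p}} (p>1 : 1 < p) (f : ℤₚ p → ℤₚ p)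
                      (lip : OneLipschitz p f) (mp : MeasurePreserving p f)
                      (n₁ : ℕ) .{{_ : NonZero n₁}} where

  n N : ℕ
  n = suc n₁
  N = p ^ n₁

  instance
    N-nonZero : NonZero N
    N-nonZero = ℕP.m^n≢0 p n₁

  -- Indexed by the coordinates (j, K) of m = j + K N.
  ∑block : (ℕ → ℕ → ℤ) → ℤ
  ∑block g = ∑[ j < N ] ∑[ i < p ∸ 1 ] g j (suc i)

  ∑-peel : ∀ g → g 0 ≡ + 0 → ∑ p g ≡ ∑[ i < p ∸ 1 ] g (suc i)
  ∑-peel g g0≡0 = begin
    ∑ p g                                    ≡⟨ cong (λ k → ∑ k g) (sym (ℕP.suc-pred p)) ⟩
    g 0 + (∑[ i < p ∸ 1 ] g (suc i))         ≡⟨ cong (_+ (∑[ i < p ∸ 1 ] g (suc i))) g0≡0 ⟩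
    + 0 + (∑[ i < p ∸ 1 ] g (suc i))         ≡⟨ ℤP.+-identityˡ _ ⟩
    ∑[ i < p ∸ 1 ] g (suc i)                 ∎
    where open ≡-Reasoning

  suc<p : ∀ {i} → i < p ∸ 1 → suc i < p
  suc<p i<p-1 = subst (suc _ <_) (ℕP.suc-pred p) (s≤s i<p-1)

  ∑block-cong : ∀ {g h} → (∀ {j K} → j < N → 1 ≤ K → K < p → g j K ≡ h j K) → ∑block g ≡ ∑block h
  ∑block-cong g≡h = ∑-cong N (λ j j<N → ∑-cong (p ∸ 1) (λ i i<p-1 → g≡h j<N (s≤s z≤n) (suc<p i<p-1)))

  ∑block-cong-mod : ∀ {g h M} → (∀ {j K} → j < N → 1 ≤ K → K < p → g j K ≡ h j K mod M) → ∑block g ≡ ∑block h mod M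
  ∑block-cong-mod g≡h = ∑-cong-mod N (λ j j<N → ∑-cong-mod (p ∸ 1) (λ i i<p-1 → g≡h j<N (s≤s z≤n) (suc<p i<p-1)))

  ∑block-distrib-+ : ∀ g h → ∑block (λ j K → g j K + h j K) ≡ ∑block g + ∑block h
  ∑block-distrib-+ g h = trans (∑-cong N (λ j _ → ∑-distrib-+ (p ∸ 1) _ _)) (∑-distrib-+ N _ _)

  ∑block-distribˡ-* : ∀ c g → ∑block (λ j K → c * g j K) ≡ c * ∑block g
  ∑block-distribˡ-* c g = trans (∑-cong N (λ j _ → ∑-distribˡ-* (p ∸ 1) c _)) (∑-distribˡ-* N c _)

  sumℤ-block : ∀ (g : ℕ → ℤ) → sumℤ (map g (block p n)) ≡ ∑block (λ j K → g (j ℕ.+ K ℕ.* N))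
  sumℤ-block g = begin
    sumℤ (map g (block p n))
      ≡⟨ sumℤ-applyUpTo g (N ℕ.+_) (p ℕ.* N ∸ N) ⟩
    ∑[ t < p ℕ.* N ∸ N ] g (N ℕ.+ t)
      ≡⟨ cong (λ k → ∑ k (λ t → g (N ℕ.+ t))) block-length ⟩
    ∑[ t < (p ∸ 1) ℕ.* N ] g (N ℕ.+ t)
      ≡⟨ ∑-product (p ∸ 1) N (λ t → g (N ℕ.+ t)) ⟩
    ∑[ i < p ∸ 1 ] ∑[ j < N ] g (N ℕ.+ (i ℕ.* N ℕ.+ j))
      ≡⟨ ∑-comm (p ∸ 1) N (λ i j → g (N ℕ.+ (i ℕ.* N ℕ.+ j))) ⟩
    ∑[ j < N ] ∑[ i < p ∸ 1 ] g (N ℕ.+ (i ℕ.* N ℕ.+ j))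
      ≡⟨ ∑-cong N (λ j _ → ∑-cong (p ∸ 1) (λ i _ → cong g (reindex N i j))) ⟩
    ∑block (λ j K → g (j ℕ.+ K ℕ.* N)) ∎
    where
    open ≡-Reasoning
    block-length : p ℕ.* N ∸ N ≡ (p ∸ 1) ℕ.* N
    block-length = trans (cong (λ k → k ℕ.* N ∸ N) (sym (ℕP.suc-pred p))) (ℕP.m+n∸m≡n N _)
    reindex : ∀ N i j → N ℕ.+ (i ℕ.* N ℕ.+ j) ≡ j ℕ.+ suc i ℕ.* N
    reindex = ℕ-solve-∀

  ∑-fibres : ∀ (g : ℕ → ℤ) → ∑ (p ℕ.* N) g ≡ ∑[ j < N ] ∑[ k < p ] g (j ℕ.+ k ℕ.* N)
  ∑-fibres g = begin
    ∑ (p ℕ.* N) g                                ≡⟨ ∑-product p N g ⟩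
    ∑[ k < p ] ∑[ j < N ] g (k ℕ.* N ℕ.+ j)      ≡⟨ ∑-comm p N (λ k j → g (k ℕ.* N ℕ.+ j)) ⟩
    ∑[ j < N ] ∑[ k < p ] g (k ℕ.* N ℕ.+ j)
      ≡⟨ ∑-cong N (λ j _ → ∑-cong p (λ k _ → cong g (ℕP.+-comm (k ℕ.* N) j))) ⟩
    ∑[ j < N ] ∑[ k < p ] g (j ℕ.+ k ℕ.* N)      ∎
    where open ≡-Reasoning

  d e : ℕ → ℕ
  d m = toℕ (f (ιℕ p m) n₁)
  e m = toℕ (f (ιℕ p m) n)

  R F : ℕ → ℕ
  R m = res p (f (ιℕ p m)) n₁
  F m = res p (f (ιℕ p m)) (suc n)

  F≡ : ∀ m → + F m ≡ + R m + + N * + d m + + p * + N * + e m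
  F≡ m = begin
    + (R m ℕ.+ d m ℕ.* N ℕ.+ e m ℕ.* (p ℕ.* N))        ≡⟨ ℤP.pos-+ (R m ℕ.+ d m ℕ.* N) _ ⟩
    + (R m ℕ.+ d m ℕ.* N) + + (e m ℕ.* (p ℕ.* N))     ≡⟨ cong₂ _+_ (ℤP.pos-+ (R m) _) (ℤP.pos-* (e m) _) ⟩
    + R m + + (d m ℕ.* N) + + e m * + (p ℕ.* N)      ≡⟨ cong₂ (λ u v → + R m + u + + e m * v) (ℤP.pos-* (d m) N) (ℤP.pos-* p N) ⟩
    + R m + + d m * + N + + e m * (+ p * + N)        ≡⟨ regroup (+ R m) (+ d m) (+ e m) (+ N) (+ p) ⟩
    + R m + + N * + d m + + p * + N * + e m          ∎
    where
    open ≡-Reasoning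
    regroup : ∀ r d e N p → r + d * N + e * (p * N) ≡ r + N * d + p * N * e
    regroup = solve-∀

  ιℕ-fibre-divisible : ∀ j K → DivBy p n₁ (_-ₚ_ p (ιℕ p (j ℕ.+ K ℕ.* N)) (ιℕ p j))
  ιℕ-fibre-divisible j K = from (DivBy⇔res≡0 p n₁ _) (mod⇒≡ (res<p^ p _ n₁) (ℕ.>-nonZero⁻¹ N) (begin
    + res p (_-ₚ_ p (ιℕ p (j ℕ.+ K ℕ.* N)) (ιℕ p j)) n₁  ≈⟨ res--ₚ p _ _ n₁ ⟩
    + res p (ιℕ p (j ℕ.+ K ℕ.* N)) n₁ - + res p (ιℕ p j) n₁ ≈⟨ minus-cong-mod (res-ιℕ p _ n₁) (res-ιℕ p j n₁) ⟩
    + (j ℕ.+ K ℕ.* N) - + j                               ≡⟨ cong (_- + j) (pos-+-* j K N) ⟩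
    + j + + K * + N - + j                                 ≡⟨ j+KN-j≡ (+ j) (+ K) (+ N) ⟩
    + 0 + + K * + N                                       ≈⟨ +-multiple-mod (+ 0) (+ K) N ⟩
    + 0                                                   ∎))
    where
    open Equivalence
    open ModReasoning N
    j+KN-j≡ : ∀ j K N → (j + K * N) - j ≡ + 0 + K * N
    j+KN-j≡ = solve-∀

  f-fibre-divisible : ∀ j K → DivBy p n₁ (_-ₚ_ p (f (ιℕ p (j ℕ.+ K ℕ.* N))) (f (ιℕ p j)))
  f-fibre-divisible j K = lip _ _ n₁ (ιℕ-fibre-divisible j K)

  R-fibre : ∀ j K → R (j ℕ.+ K ℕ.* N) ≡ R j
  R-fibre j K = res--ₚ≡0⇒res≡ p _ _ n₁ (to (DivBy⇔res≡0 p n₁ _) (f-fibre-divisible j K))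
    where open Equivalence

  B-fibre : ∀ j K → j < N → 1 ≤ K → K < p → B p f (j ℕ.+ K ℕ.* N) ≡ _-ₚ_ p (f (ιℕ p (j ℕ.+ K ℕ.* N))) (f (ιℕ p j))
  B-fibre j K j<N K≥1 K<p = begin
    B p f m            ≡⟨ if-<ᵇ-no _ _ p≤m ⟩
    Δ (m ∸ q p m)      ≡⟨ cong (λ r → Δ (m ∸ r)) (q-leading p p>1 n₁ j K j<N K≥1 K<p) ⟩
    Δ (m ∸ K ℕ.* N)    ≡⟨ cong Δ (ℕP.m+n∸n≡m j (K ℕ.* N)) ⟩
    Δ j                ∎
    where
    open ≡-Reasoning
    m = j ℕ.+ K ℕ.* N
    Δ : ℕ → ℤₚ p
    Δ r = _-ₚ_ p (f (ιℕ p m)) (f (ιℕ p r))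
    p≤m : p ≤ m
    p≤m = ℕP.≤-trans (ℕP.m≤m*n p 1) (ℕP.≤-trans (ℕP.^-monoʳ-≤ p (ℕ.>-nonZero⁻¹ n₁))
                    (ℕP.≤-trans (ℕP.m≤n*m N K {{ℕ.>-nonZero K≥1}}) (ℕP.m≤n+m _ j)))

  module _ {j K} (j<N : j < N) (K≥1 : 1 ≤ K) (K<p : K < p) where

    private
      m = j ℕ.+ K ℕ.* N

    res-B≡0 : res p (B p f m) n₁ ≡ 0
    res-B≡0 = subst (λ x → res p x n₁ ≡ 0) (sym (B-fibre j K j<N K≥1 K<p))
                        (to (DivBy⇔res≡0 p n₁ _) (f-fibre-divisible j K))
      where open Equivalence

    res-B≡N*res-b : + res p (B p f m) (suc n) ≡ + N * + res p (b p f n m) 2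
    res-B≡N*res-b = begin
      + res p (B p f m) (suc n)                                   ≡⟨ cong (λ k → + res p (B p f m) k) (ℕP.+-comm 2 n₁) ⟩
      + res p (B p f m) (n₁ ℕ.+ 2)                                ≡⟨ cong +_ (res-+ p (B p f m) n₁ 2) ⟩
      + (res p (B p f m) n₁ ℕ.+ N ℕ.* res p (b p f n m) 2)         ≡⟨ cong (λ r → + (r ℕ.+ N ℕ.* res p (b p f n m) 2)) res-B≡0 ⟩
      + (N ℕ.* res p (b p f n m) 2)                               ≡⟨ ℤP.pos-* N _ ⟩
      + N * + res p (b p f n m) 2                                 ∎
      where open ≡-Reasoning

    res-B≡res-f-difference : ∀ k → + res p (B p f m) k ≡ + res p (f (ιℕ p m)) k - + res p (f (ιℕ p j)) k mod p ^ k
    res-B≡res-f-difference k =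
      mod-trans (mod-reflexive (cong (λ x → + res p x k) (B-fibre j K j<N K≥1 K<p))) (res--ₚ p _ _ k)

  res-f-fibre : ∀ j k → res p (f (ιℕ p (j ℕ.+ k ℕ.* N))) n ≡ R j ℕ.+ d (j ℕ.+ k ℕ.* N) ℕ.* N
  res-f-fibre j k = cong (ℕ._+ d (j ℕ.+ k ℕ.* N) ℕ.* N) (R-fibre j k)

  fibre<p^n : ∀ {j k} → j < N → k < p → j ℕ.+ k ℕ.* N < p ^ n
  fibre<p^n {j} {k} j<N k<p = ℕP.<-≤-trans (ℕP.+-monoˡ-< (k ℕ.* N) j<N) (ℕP.*-monoˡ-≤ N k<p)

  -- Measure preservation at level n: the digit f_{m,n-1} separates the p points of a fibre.
  d-fibre-injective : ∀ {j} → j < N → ∀ {k₁ k₂} → k₁ < p → k₂ < p →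
                      d (j ℕ.+ k₁ ℕ.* N) ≡ d (j ℕ.+ k₂ ℕ.* N) → k₁ ≡ k₂
  d-fibre-injective {j} j<N {k₁} {k₂} k₁<p k₂<p eq = ℕP.*-cancelʳ-≡ k₁ k₂ N (ℕP.+-cancelˡ-≡ j _ _
    (measurePreserving⇒res-injective {f = f} mp n (fibre<p^n j<N k₁<p) (fibre<p^n j<N k₂<p)
      (trans (res-f-fibre j k₁) (trans (cong (λ r → R j ℕ.+ r ℕ.* N) eq) (sym (res-f-fibre j k₂))))))

  G : ℤ
  G = ∑[ i < p ] + i

  d-fibre-sum : ∀ {j} → j < N → ∑[ k < p ] + d (j ℕ.+ k ℕ.* N) ≡ G
  d-fibre-sum j<N = ∑-permute p _ (λ _ _ → FinP.toℕ<n _) (λ _ _ k₁<p k₂<p → d-fibre-injective j<N k₁<p k₂<p)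

  -- The residue of f_{j+kN,n-1} - f_{j,n-1} modulo p.
  digitGap : ℕ → ℕ → ℕ
  digitGap j k = (d (j ℕ.+ k ℕ.* N) ℕ.+ (p ∸ d j)) % p

  digitGap≡ : ∀ j k → + digitGap j k ≡ + d (j ℕ.+ k ℕ.* N) - + d j mod p
  digitGap≡ j k = mod-trans (%-mod _ p) (+∸-mod _ (ℕP.<⇒≤ (FinP.toℕ<n (f (ιℕ p j) n₁))))

  digitGap-zero : ∀ j → digitGap j 0 ≡ 0
  digitGap-zero j = begin
    (d (j ℕ.+ 0) ℕ.+ (p ∸ d j)) % p   ≡⟨ cong (λ r → (d r ℕ.+ (p ∸ d j)) % p) (ℕP.+-identityʳ j) ⟩
    (d j ℕ.+ (p ∸ d j)) % p           ≡⟨ cong (_% p) (ℕP.m+[n∸m]≡n (ℕP.<⇒≤ (FinP.toℕ<n (f (ιℕ p j) n₁)))) ⟩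
    p % p                             ≡⟨ ℕDM.n%n≡0 p ⟩
    0                                 ∎
    where open ≡-Reasoning

  digitGap-injective : ∀ {j} → j < N → ∀ k₁ k₂ → k₁ < p → k₂ < p → digitGap j k₁ ≡ digitGap j k₂ → k₁ ≡ k₂
  digitGap-injective {j} j<N k₁ k₂ k₁<p k₂<p eq = d-fibre-injective j<N k₁<p k₂<p
    (mod⇒≡ (FinP.toℕ<n _) (FinP.toℕ<n _) (+-cancelʳ-mod {c = + d j}
      (mod-trans (mod-sym (digitGap≡ j k₁)) (mod-trans (mod-reflexive (cong +_ eq)) (digitGap≡ j k₂)))))

  ∑-digitGap : ∀ {j} → j < N → ∑[ i < p ∸ 1 ] + digitGap j (suc i) ≡ G
  ∑-digitGap {j} j<N = begin
    ∑[ i < p ∸ 1 ] + digitGap j (suc i)  ≡⟨ sym (∑-peel (λ k → + digitGap j k) (cong +_ (digitGap-zero j))) ⟩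
    ∑[ k < p ] + digitGap j k            ≡⟨ ∑-permute p (digitGap j) (λ k _ → ℕDM.m%n<n _ p) (digitGap-injective j<N) ⟩
    G                                    ∎
    where open ≡-Reasoning

  b₀ b₁ : ℕ → ℕ
  b₀ m = toℕ (B p f m n₁)
  b₁ m = toℕ (B p f m (suc n₁))

  b₀≡digitGap : ∀ {j K} → j < N → 1 ≤ K → K < p → b₀ (j ℕ.+ K ℕ.* N) ≡ digitGap j K
  b₀≡digitGap {j} {K} j<N K≥1 K<p = mod⇒≡ (FinP.toℕ<n _) (ℕDM.m%n<n _ p)
    (mod-trans b₀≡d-d (mod-sym (digitGap≡ j K)))
    where
    m = j ℕ.+ K ℕ.* N
    N*b₀≡ : + res p (B p f m) n ≡ + N * + b₀ m
    N*b₀≡ = trans (cong (λ r → + (r ℕ.+ b₀ m ℕ.* N)) (res-B≡0 j<N K≥1 K<p))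
                  (trans (ℤP.pos-* (b₀ m) N) (ℤP.*-comm (+ b₀ m) (+ N)))
    N*d-d≡ : + res p (f (ιℕ p m)) n - + res p (f (ιℕ p j)) n ≡ + N * (+ d m - + d j)
    N*d-d≡ = begin
      + res p (f (ιℕ p m)) n - + res p (f (ιℕ p j)) n
        ≡⟨ cong₂ _-_ (cong +_ (res-f-fibre j K)) (cong +_ (cong (R j ℕ.+_) (ℕP.*-comm (d j) N))) ⟩
      + (R j ℕ.+ d m ℕ.* N) - + (R j ℕ.+ N ℕ.* d j)      ≡⟨ cong₂ _-_ (pos-+-* (R j) (d m) N) (pos-+-* (R j) N (d j)) ⟩
      + R j + + d m * + N - (+ R j + + N * + d j)         ≡⟨ cancel (+ R j) (+ d m) (+ d j) (+ N) ⟩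
      + N * (+ d m - + d j)                               ∎
      where
      open ≡-Reasoning
      cancel : ∀ r a b N → r + a * N - (r + N * b) ≡ N * (a - b)
      cancel = solve-∀
    b₀≡d-d : + b₀ m ≡ + d m - + d j mod p
    b₀≡d-d = to (*-cancelˡ-mod⇔ N) (subst (+ N * + b₀ m ≡ + N * (+ d m - + d j) mod_) (ℕP.*-comm p N)
      (subst₂ (λ u v → u ≡ v mod p ^ n) N*b₀≡ N*d-d≡ (res-B≡res-f-difference j<N K≥1 K<p n)))
      where open Equivalence

  -- Σ_m b_m modulo p², summed termwise as b_{m0} + p b_{m1}.
  Y : ℤ
  Y = ∑block (λ j K → + res p (b p f n (j ℕ.+ K ℕ.* N)) 2)

  D : ℤ
  D = + S p f n - + S p f n₁

  W : ℕ → ℤ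
  W j = ∑[ k < p ] + e (j ℕ.+ k ℕ.* N)

  S-upper : + S p f n ≡ ∑[ j < N ] W j
  S-upper = trans (pos-foldr-+ _ (upTo (p ^ n))) (trans (sumℤ-applyUpTo _ id (p ^ n)) (∑-fibres (λ m → + e m)))

  S-lower : + S p f n₁ ≡ ∑[ j < N ] + d j
  S-lower = trans (pos-foldr-+ _ (upTo N)) (sumℤ-applyUpTo _ id N)

  Σb≡Y : + res p (Σb p f n) 2 ≡ Y mod p ^ 2
  Σb≡Y = mod-trans (res-sumₚ p (map (b p f n) (block p n)) 2)
    (mod-reflexive (trans (cong sumℤ (sym (ListP.map-∘ (block p n)))) (sumℤ-block (λ m → + res p (b p f n m) 2))))

  ∑block-res-B : ∑block (λ j K → + res p (B p f (j ℕ.+ K ℕ.* N)) (suc n)) ≡ + N * Y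
  ∑block-res-B = trans (∑block-cong (λ j<N K≥1 K<p → res-B≡N*res-b j<N K≥1 K<p))
                       (∑block-distribˡ-* (+ N) (λ j K → + res p (b p f n (j ℕ.+ K ℕ.* N)) 2))

  ΣB≡N*Y : + res p (ΣB p f n) (suc n) ≡ + N * Y mod p ^ suc n
  ΣB≡N*Y = mod-trans (res-sumₚ p (map (B p f) (block p n)) (suc n)) (mod-reflexive (begin
    sumℤ (map (λ x → + res p x (suc n)) (map (B p f) (block p n)))  ≡⟨ cong sumℤ (sym (ListP.map-∘ (block p n))) ⟩
    sumℤ (map (λ m → + res p (B p f m) (suc n)) (block p n))        ≡⟨ sumℤ-block (λ m → + res p (B p f m) (suc n)) ⟩
    ∑block (λ j K → + res p (B p f (j ℕ.+ K ℕ.* N)) (suc n))        ≡⟨ ∑block-res-B ⟩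
    + N * Y                                                        ∎))
    where open ≡-Reasoning

  Y≡N*G+p*T : Y ≡ + N * G + + p * + T p f n
  Y≡N*G+p*T = begin
    Y
      ≡⟨ ∑block-cong (λ {j} {K} _ _ _ → res-2 p (b p f n (j ℕ.+ K ℕ.* N))) ⟩
    ∑block (λ j K → + b₀ (j ℕ.+ K ℕ.* N) + + p * + b₁ (j ℕ.+ K ℕ.* N))
      ≡⟨ ∑block-distrib-+ (λ j K → + b₀ (j ℕ.+ K ℕ.* N)) (λ j K → + p * + b₁ (j ℕ.+ K ℕ.* N)) ⟩
    ∑block (λ j K → + b₀ (j ℕ.+ K ℕ.* N)) + ∑block (λ j K → + p * + b₁ (j ℕ.+ K ℕ.* N))
      ≡⟨ cong₂ _+_ ∑block-b₀ (∑block-distribˡ-* (+ p) (λ j K → + b₁ (j ℕ.+ K ℕ.* N))) ⟩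
    + N * G + + p * ∑block (λ j K → + b₁ (j ℕ.+ K ℕ.* N))
      ≡⟨ cong (λ t → + N * G + + p * t) ∑block-b₁ ⟩
    + N * G + + p * + T p f n
      ∎
    where
    open ≡-Reasoning
    ∑block-b₀ : ∑block (λ j K → + b₀ (j ℕ.+ K ℕ.* N)) ≡ + N * G
    ∑block-b₀ = begin
      ∑block (λ j K → + b₀ (j ℕ.+ K ℕ.* N))        ≡⟨ ∑block-cong (λ j<N K≥1 K<p → cong +_ (b₀≡digitGap j<N K≥1 K<p)) ⟩
      ∑block (λ j K → + digitGap j K)              ≡⟨ ∑-cong N (λ _ j<N → ∑-digitGap j<N) ⟩
      ∑[ j < N ] G                                 ≡⟨ ∑-const N G ⟩
      + N * G                                      ∎
    ∑block-b₁ : ∑block (λ j K → + b₁ (j ℕ.+ K ℕ.* N)) ≡ + T p f n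
    ∑block-b₁ = sym (trans (pos-foldr-+ _ (block p n)) (sumℤ-block (λ m → + b₁ m)))

  -- Lipschitz: f(j + kN) ≡ f(j) mod N, so only the digits f_{·,n-1} and f_{·,n} survive the telescoping.
  fibre-sum : ∀ {j} → j < N →
              ∑[ k < p ] (+ F (j ℕ.+ k ℕ.* N) - + F j) ≡ + N * G + - (+ p * + N) * + d j + + p * + N * W j mod p ^ suc n
  fibre-sum {j} j<N = begin
    ∑[ k < p ] (+ F (j ℕ.+ k ℕ.* N) - + F j)
      ≡⟨ ∑-cong p (λ k _ → F-fibre k) ⟩
    ∑[ k < p ] ((+ R j - + F j) + + N * + d (j ℕ.+ k ℕ.* N) + + p * + N * + e (j ℕ.+ k ℕ.* N))
      ≡⟨ ∑-affine p (+ R j - + F j) (+ N) (+ p * + N) _ _ ⟩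
    + p * (+ R j - + F j) + + N * (∑[ k < p ] + d (j ℕ.+ k ℕ.* N)) + + p * + N * W j
      ≡⟨ cong (λ t → + p * (+ R j - + F j) + + N * t + + p * + N * W j) (d-fibre-sum j<N) ⟩
    + p * (+ R j - + F j) + + N * G + + p * + N * W j
      ≡⟨ cong (λ t → + p * (+ R j - t) + + N * G + + p * + N * W j) (F≡ j) ⟩
    + p * (+ R j - (+ R j + + N * + d j + + p * + N * + e j)) + + N * G + + p * + N * W j
      ≡⟨ regroup (+ R j) (+ d j) (+ e j) (+ N) (+ p) G (W j) ⟩
    (+ N * G + - (+ p * + N) * + d j + + p * + N * W j) + (- + e j) * (+ p * (+ p * + N))
      ≡⟨ cong (λ M → (+ N * G + - (+ p * + N) * + d j + + p * + N * W j) + (- + e j) * M) p^[1+n]≡ ⟩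
    (+ N * G + - (+ p * + N) * + d j + + p * + N * W j) + (- + e j) * + (p ^ suc n)
      ≈⟨ +-multiple-mod _ (- + e j) (p ^ suc n) ⟩
    + N * G + - (+ p * + N) * + d j + + p * + N * W j ∎
    where
    open ModReasoning (p ^ suc n)
    regroup : ∀ r d e N p G W → p * (r - (r + N * d + p * N * e)) + N * G + p * N * W ≡
                                (N * G + - (p * N) * d + p * N * W) + (- e) * (p * (p * N))
    regroup = solve-∀
    p^[1+n]≡ : + p * (+ p * + N) ≡ + (p ^ suc n)
    p^[1+n]≡ = sym (trans (ℤP.pos-* p (p ℕ.* N)) (cong (+ p *_) (ℤP.pos-* p N)))
    F-fibre : ∀ k → + F (j ℕ.+ k ℕ.* N) - + F j ≡
                    (+ R j - + F j) + + N * + d (j ℕ.+ k ℕ.* N) + + p * + N * + e (j ℕ.+ k ℕ.* N)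
    F-fibre k = trans (cong (_- + F j) (trans (F≡ m) (cong (λ r → + r + + N * + d m + + p * + N * + e m) (R-fibre j k))))
                      (shuffle (+ R j) (+ F j) (+ N * + d m) (+ p * + N * + e m))
      where
      m = j ℕ.+ k ℕ.* N
      shuffle : ∀ r F a c → r + a + c - F ≡ (r - F) + a + c
      shuffle = solve-∀

  N*Y≡N*[N*G+p*D] : + N * Y ≡ + N * (+ N * G + + p * D) mod p ^ suc n
  N*Y≡N*[N*G+p*D] = begin
    + N * Y
      ≡⟨ sym ∑block-res-B ⟩
    ∑block (λ j K → + res p (B p f (j ℕ.+ K ℕ.* N)) (suc n))
      ≈⟨ ∑block-cong-mod {h = λ j K → + F (j ℕ.+ K ℕ.* N) - + F j}
                         (λ j<N K≥1 K<p → res-B≡res-f-difference j<N K≥1 K<p (suc n)) ⟩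
    ∑block (λ j K → + F (j ℕ.+ K ℕ.* N) - + F j)
      ≡⟨ ∑-cong N (λ j _ → sym (∑-peel (λ k → + F (j ℕ.+ k ℕ.* N) - + F j) (F₀-F≡0 j))) ⟩
    ∑[ j < N ] ∑[ k < p ] (+ F (j ℕ.+ k ℕ.* N) - + F j)
      ≈⟨ ∑-cong-mod N (λ _ j<N → fibre-sum j<N) ⟩
    ∑[ j < N ] (+ N * G + - (+ p * + N) * + d j + + p * + N * W j)
      ≡⟨ ∑-affine N (+ N * G) (- (+ p * + N)) (+ p * + N) (λ j → + d j) W ⟩
    + N * (+ N * G) + - (+ p * + N) * (∑[ j < N ] + d j) + + p * + N * (∑[ j < N ] W j)
      ≡⟨ cong₂ (λ u v → + N * (+ N * G) + - (+ p * + N) * u + + p * + N * v) (sym S-lower) (sym S-upper) ⟩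
    + N * (+ N * G) + - (+ p * + N) * + S p f n₁ + + p * + N * + S p f n
      ≡⟨ regroup (+ N) G (+ p) (+ S p f n₁) (+ S p f n) ⟩
    + N * (+ N * G + + p * D) ∎
    where
    open ModReasoning (p ^ suc n)
    F₀-F≡0 : ∀ j → + F (j ℕ.+ 0 ℕ.* N) - + F j ≡ + 0
    F₀-F≡0 j = trans (cong (λ m → + F m - + F j) (ℕP.+-identityʳ j)) (ℤP.+-inverseʳ (+ F j))
    regroup : ∀ N G p S₁ S₂ → N * (N * G) + - (p * N) * S₁ + p * N * S₂ ≡ N * (N * G + p * (S₂ - S₁))
    regroup = solve-∀

  p^[1+n]≡N*p^2 : p ^ suc n ≡ N ℕ.* p ^ 2
  p^[1+n]≡N*p^2 = shape N p
    where
    shape : ∀ N p → p ℕ.* (p ℕ.* N) ≡ N ℕ.* (p ℕ.* (p ℕ.* 1))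
    shape = ℕ-solve-∀

  p^2≡p*p : p ^ 2 ≡ p ℕ.* p
  p^2≡p*p = cong (p ℕ.*_) (ℕP.*-identityʳ p)

  Y≡N*G+p*D : Y ≡ + N * G + + p * D mod p ^ 2
  Y≡N*G+p*D = to (*-cancelˡ-mod⇔ N) (subst (+ N * Y ≡ + N * (+ N * G + + p * D) mod_) p^[1+n]≡N*p^2 N*Y≡N*[N*G+p*D])
    where open Equivalence

  T≡D : + T p f n ≡ D mod p
  T≡D = to (*-cancelˡ-mod⇔ p) (subst (+ p * + T p f n ≡ + p * D mod_) p^2≡p*p
    (+-cancelˡ-mod {c = + N * G} (mod-trans (mod-reflexive (sym Y≡N*G+p*T)) Y≡N*G+p*D)))
    where open Equivalence

  ΣB⇔Σb : ∀ {y y′} z → + res p y (suc n) ≡ z * + (p ^ n) mod p ^ suc n → + res p y′ 2 ≡ z * + p mod p ^ 2 →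
          Cong p (suc n) (ΣB p f n) y ⇔ Cong p 2 (Σb p f n) y′
  ΣB⇔Σb {y} {y′} z y≡ y′≡ = begin
    Cong p (suc n) (ΣB p f n) y                                 ≈⟨ Cong⇔mod p (suc n) _ y y≡ ⟩
    (+ res p (ΣB p f n) (suc n) ≡ z * + (p ^ n) mod p ^ suc n)   ≈⟨ mod-respˡ-⇔ ΣB≡N*Y ⟩
    (+ N * Y ≡ z * + (p ^ n) mod p ^ suc n)                      ≈⟨ mod-respʳ-⇔ (mod-reflexive z*p^n≡) ⟩
    (+ N * Y ≡ + N * (z * + p) mod p ^ suc n)                    ≡⟨ cong (+ N * Y ≡ + N * (z * + p) mod_) p^[1+n]≡N*p^2 ⟩
    (+ N * Y ≡ + N * (z * + p) mod N ℕ.* p ^ 2)                  ≈⟨ *-cancelˡ-mod⇔ N ⟩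
    (Y ≡ z * + p mod p ^ 2)                                      ≈⟨ mod-respˡ-⇔ Σb≡Y ⟨
    (+ res p (Σb p f n) 2 ≡ z * + p mod p ^ 2)                   ≈⟨ Cong⇔mod p 2 _ y′ y′≡ ⟨
    Cong p 2 (Σb p f n) y′                                      ∎
    where
    open SetoidReasoning (⇔-setoid 0ℓ)
    z*p^n≡ : z * + (p ^ n) ≡ + N * (z * + p)
    z*p^n≡ = trans (cong (z *_) (ℤP.pos-* p N)) (shuffle z (+ p) (+ N))
      where
      shuffle : ∀ z p N → z * (p * N) ≡ N * (z * p)
      shuffle = solve-∀

  Σb⇔S : ∀ {y′} z ε {u} → + N * G ≡ + p * ε mod p ^ 2 → + res p y′ 2 ≡ z * + p mod p ^ 2 →
         u ≡ D - (z - ε) mod p → Cong p 2 (Σb p f n) y′ ⇔ (+ p ∣ u)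
  Σb⇔S {y′} z ε {u} N*G≡ y′≡ u≡ = begin
    Cong p 2 (Σb p f n) y′                          ≈⟨ Cong⇔mod p 2 _ y′ y′≡ ⟩
    (+ res p (Σb p f n) 2 ≡ z * + p mod p ^ 2)      ≈⟨ mod-respˡ-⇔ Σb≡Y ⟩
    (Y ≡ z * + p mod p ^ 2)                         ≈⟨ mod-respˡ-⇔ (mod-trans Y≡N*G+p*D (+-cong-mod N*G≡ (mod-refl {+ p * D}))) ⟩
    (+ p * ε + + p * D ≡ z * + p mod p ^ 2)
      ≡⟨ cong₂ (λ a c → a ≡ c mod p ^ 2) (sym (ℤP.*-distribˡ-+ (+ p) ε D)) (ℤP.*-comm z (+ p)) ⟩
    (+ p * (ε + D) ≡ + p * z mod p ^ 2)             ≡⟨ cong (+ p * (ε + D) ≡ + p * z mod_) p^2≡p*p ⟩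
    (+ p * (ε + D) ≡ + p * z mod p ℕ.* p)           ≈⟨ *-cancelˡ-mod⇔ p ⟩
    (ε + D ≡ z mod p)                               ≈⟨ mod⇔-≡0 ⟩
    (ε + D - z ≡ + 0 mod p)                         ≈⟨ mod-respˡ-⇔ (mod-trans (mod-reflexive (rearrange ε D z)) (mod-sym u≡)) ⟩
    (u ≡ + 0 mod p)                                 ≈⟨ ∣⇔≡0-mod ⟨
    + p ∣ u                                         ∎
    where
    open SetoidReasoning (⇔-setoid 0ℓ)
    rearrange : ∀ ε D z → ε + D - z ≡ D - (z - ε)
    rearrange = solve-∀

  S-gap≡T-gap : ∀ w → + S p f n - (+ S p f n₁ + w) ≡ + T p f n - w mod p
  S-gap≡T-gap w = mod-trans (mod-reflexive (regroup (+ S p f n) (+ S p f n₁) w)) (minus-cong-mod (mod-sym T≡D) mod-refl)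
    where
    regroup : ∀ a b w → a - (b + w) ≡ (a - b) - w
    regroup = solve-∀

  congruenceChain : + N * G ≡ + p * + 0 mod p ^ 2 → ∀ r → CongruenceChain p f n r
  congruenceChain N*G≡0 r =
      ΣB⇔Σb r (res-ιℤ p _ (suc n)) (res-ιℤ p _ 2)
    , Σb⇔S r (+ 0) N*G≡0 (res-ιℤ p _ 2) (mod-reflexive (regroup (+ S p f n) (+ S p f n₁) r))
    , ∣-cong-mod (S-gap≡T-gap r)
    where
    regroup : ∀ a b r → a - (b + r) ≡ (a - b) - (r - + 0)
    regroup = solve-∀

-- The constant N·(0 + 1 + ⋯ + (p-1)) modulo p²

∑-range-odd : ∀ h → ∑[ i < suc (2 ℕ.* h) ] + i ≡ + suc (2 ℕ.* h) * + h
∑-range-odd h = ℤP.*-cancelˡ-≡ (+ 2) _ _ (trans (∑-range-double (suc (2 ℕ.* h)) (+ 0))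
  (trans (cong (λ t → t * (+ 2 * + 0 + t - + 1)) (pos-+-* 1 2 h))
  (trans (halve (+ h)) (cong (λ t → + 2 * (t * + h)) (sym (pos-+-* 1 2 h))))))
  where
  halve : ∀ h → (+ 1 + + 2 * h) * (+ 2 * + 0 + (+ 1 + + 2 * h) - + 1) ≡ + 2 * ((+ 1 + + 2 * h) * h)
  halve = solve-∀

prime⇒≡2⊎odd : ∀ {p} → Prime p → p ≡ 2 ⊎ ∃ λ h → p ≡ suc (2 ℕ.* h)
prime⇒≡2⊎odd {p} pr with p % 2 in p%2≡ | ℕDM.m%n<n p 2
... | 0           | _ = inj₁ (ℕP.≤-antisym p≤2 (ℕ.nonTrivial⇒n>1 p {{prime⇒nonTrivial pr}}))
  where
  p≤2 : p ≤ 2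
  p≤2 with ℕP.≤-<-connex p 2
  ... | inj₁ p≤2 = p≤2
  ... | inj₂ 2<p = ⊥-elim (prime⇒¬composite pr (composite 2<p (ℕD.m%n≡0⇒n∣m p 2 p%2≡)))
... | 1           | _ = inj₂ (p / 2 , p≡)
  where
  open ≡-Reasoning
  p≡ : p ≡ suc (2 ℕ.* (p / 2))
  p≡ = begin
    p                       ≡⟨ m≡m%n+[m/n]*n p 2 ⟩
    p % 2 ℕ.+ p / 2 ℕ.* 2   ≡⟨ cong (λ r → r ℕ.+ p / 2 ℕ.* 2) p%2≡ ⟩
    suc (p / 2 ℕ.* 2)       ≡⟨ cong suc (ℕP.*-comm (p / 2) 2) ⟩
    suc (2 ℕ.* (p / 2))     ∎
... | suc (suc _) | s≤s (s≤s ())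

N*G≡0-odd : ∀ {p} → (∃ λ h → p ≡ suc (2 ℕ.* h)) → ∀ k → + (p ^ suc k) * (∑[ i < p ] + i) ≡ + p * + 0 mod p ^ 2
N*G≡0-odd {p} (h , p≡) k = subst₂ (λ u v → u ≡ v mod p ^ 2) (sym N*G≡) (sym (ℤP.*-zeroʳ (+ p)))
                                 (+-multiple-mod (+ 0) (+ (p ^ k) * + h) (p ^ 2))
  where
  G≡ : ∑[ i < p ] + i ≡ + p * + h
  G≡ = subst (λ q → ∑[ i < q ] + i ≡ + q * + h) (sym p≡) (∑-range-odd h)
  N*G≡ : + (p ^ suc k) * (∑[ i < p ] + i) ≡ + 0 + + (p ^ k) * + h * + (p ^ 2)
  N*G≡ = begin
    + (p ^ suc k) * (∑[ i < p ] + i)       ≡⟨ cong₂ _*_ (ℤP.pos-* p (p ^ k)) G≡ ⟩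
    + p * + (p ^ k) * (+ p * + h)          ≡⟨ shuffle (+ p) (+ (p ^ k)) (+ h) ⟩
    + 0 + + (p ^ k) * + h * (+ p * (+ p * + 1))
      ≡⟨ cong (λ t → + 0 + + (p ^ k) * + h * t) (sym (trans (ℤP.pos-* p (p ℕ.* 1)) (cong (+ p *_) (ℤP.pos-* p 1)))) ⟩
    + 0 + + (p ^ k) * + h * + (p ^ 2)      ∎
    where
    open ≡-Reasoning
    shuffle : ∀ p P h → p * P * (p * h) ≡ + 0 + P * h * (p * (p * + 1))
    shuffle = solve-∀

N*G≡0-two : ∀ k → + (2 ^ suc (suc k)) * (∑[ i < 2 ] + i) ≡ + 2 * + 0 mod 2 ^ 2
N*G≡0-two k = subst (_≡ + 0 mod 4) (sym N*G≡) (+-multiple-mod (+ 0) (+ (2 ^ k)) 4)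
  where
  shape : ∀ P → 2 ℕ.* (2 ℕ.* P) ℕ.* 1 ≡ P ℕ.* 4
  shape = ℕ-solve-∀
  N*G≡ : + (2 ^ suc (suc k)) * (∑[ i < 2 ] + i) ≡ + 0 + + (2 ^ k) * + 4
  N*G≡ = trans (sym (ℤP.pos-* (2 ^ suc (suc k)) 1))
               (trans (cong +_ (shape (2 ^ k))) (trans (ℤP.pos-* (2 ^ k) 4) (sym (ℤP.+-identityˡ _))))

N*G≡0 : ∀ {p} → Prime p → ∀ k → + (p ^ suc (suc k)) * (∑[ i < p ] + i) ≡ + p * + 0 mod p ^ 2
N*G≡0 pr k with prime⇒≡2⊎odd pr
... | inj₁ refl       = N*G≡0-two k
... | inj₂ odd        = N*G≡0-odd odd (suc k)

prime>2⇒odd : ∀ {p} → Prime p → p > 2 → ∃ λ h → p ≡ suc (2 ℕ.* h)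
prime>2⇒odd pr p>2 with prime⇒≡2⊎odd pr
... | inj₁ refl = ⊥-elim (ℕP.<-irrefl refl p>2)
... | inj₂ odd  = odd

-- Here N G = 2 · 1 is p ε with ε = 1 rather than 0 modulo 4, which shifts every residue by one.
dyadicChains : (f : ℤₚ 2 → ℤₚ 2) → OneLipschitz 2 f → MeasurePreserving 2 f →
  ((Cong 2 3 (ΣB 2 f 2) (ιℕ 2 4) ⇔ Cong 2 2 (Σb 2 f 2) (ιℕ 2 2))
    × (Cong 2 2 (Σb 2 f 2) (ιℕ 2 2) ⇔ + 2 ∣ (+ S 2 f 2 - + S 2 f 1))
    × (+ 2 ∣ (+ S 2 f 2 - + S 2 f 1) ⇔ + 2 ∣ + T 2 f 2))
  × ((Cong 2 3 (ΣB 2 f 2) (ιℕ 2 0) ⇔ Cong 2 2 (Σb 2 f 2) (ιℕ 2 0))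
    × (Cong 2 2 (Σb 2 f 2) (ιℕ 2 0) ⇔ + 2 ∣ (+ S 2 f 2 - (+ S 2 f 1 + + 1)))
    × (+ 2 ∣ (+ S 2 f 2 - (+ S 2 f 1 + + 1)) ⇔ + 2 ∣ (+ T 2 f 2 - + 1)))
dyadicChains f lip mp =
    ( ΣB⇔Σb (+ 1) (res-ιℕ 2 4 3) (res-ιℕ 2 2 2)
    , Σb⇔S (+ 1) (+ 1) mod-refl (res-ιℕ 2 2 2) (mod-reflexive (sym (ℤP.+-identityʳ D)))
    , ∣-cong-mod (mod-sym T≡D) )
  , ( ΣB⇔Σb (+ 0) (res-ιℕ 2 0 3) (res-ιℕ 2 0 2)
    , Σb⇔S (+ 0) (+ 1) mod-refl (res-ιℕ 2 0 2) S-gap≡D+1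
    , ∣-cong-mod (S-gap≡T-gap (+ 1)) )
  where
  open VanDerPutBlock 2 (s≤s (s≤s z≤n)) f lip mp 1
  S-gap≡D+1 : + S 2 f 2 - (+ S 2 f 1 + + 1) ≡ D - (+ 0 - + 1) mod 2
  S-gap≡D+1 = mod-sym (subst (_≡ + S 2 f 2 - (+ S 2 f 1 + + 1) mod 2) (shift (+ S 2 f 2) (+ S 2 f 1))
                             (+-multiple-mod (+ S 2 f 2 - (+ S 2 f 1 + + 1)) (+ 1) 2))
    where
    shift : ∀ a b → a - (b + + 1) + + 1 * + 2 ≡ (a - b) - (+ 0 - + 1)
    shift = solve-∀

theorem3p10 : (p : ℕ) .{{_ : NonZero p}} → Prime p →
  (f : ℤₚ p → ℤₚ p) → OneLipschitz p f → MeasurePreserving p f →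
  -- (1)(a) n = 2, p = 2
  (p ≡ 2 →
    ((Cong p 3 (ΣB p f 2) (ιℕ p 4) ⇔ Cong p 2 (Σb p f 2) (ιℕ p 2))
      × (Cong p 2 (Σb p f 2) (ιℕ p 2) ⇔ (+ p) ∣ (+ S p f 2 - + S p f 1))
      × ((+ p) ∣ (+ S p f 2 - + S p f 1) ⇔ (+ p) ∣ (+ T p f 2)))
    × ((Cong p 3 (ΣB p f 2) (ιℕ p 0) ⇔ Cong p 2 (Σb p f 2) (ιℕ p 0))
      × (Cong p 2 (Σb p f 2) (ιℕ p 0) ⇔ (+ p) ∣ (+ S p f 2 - (+ S p f 1 +ℤ + 1)))
      × ((+ p) ∣ (+ S p f 2 - (+ S p f 1 +ℤ + 1)) ⇔ (+ p) ∣ (+ T p f 2 - + 1))))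
  -- (1)(b) n = 2, p > 2
  × (p > 2 → (r : ℤ) →
    (Cong p 3 (ΣB p f 2) (ιℤ p (r *ℤ + (p ^ 2))) ⇔ Cong p 2 (Σb p f 2) (ιℤ p (r *ℤ + p)))
      × (Cong p 2 (Σb p f 2) (ιℤ p (r *ℤ + p)) ⇔ (+ p) ∣ (+ S p f 2 - (+ S p f 1 +ℤ r)))
      × ((+ p) ∣ (+ S p f 2 - (+ S p f 1 +ℤ r)) ⇔ (+ p) ∣ (+ T p f 2 - r)))
  -- (2) n ≥ 3, any prime p
  × ((n : ℕ) → n ≥ 3 → (r : ℤ) →
    (Cong p (suc n) (ΣB p f n) (ιℤ p (r *ℤ + (p ^ n))) ⇔ Cong p 2 (Σb p f n) (ιℤ p (r *ℤ + p)))
      × (Cong p 2 (Σb p f n) (ιℤ p (r *ℤ + p)) ⇔ (+ p) ∣ (+ S p f n - (+ S p f (n ∸ 1) +ℤ r)))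
      × ((+ p) ∣ (+ S p f n - (+ S p f (n ∸ 1) +ℤ r)) ⇔ (+ p) ∣ (+ T p f n - r)))
theorem3p10 p pr f lip mp =
    (λ { refl → dyadicChains f lip mp })
  , (λ p>2 r → Block.congruenceChain 1 (N*G≡0-odd (prime>2⇒odd pr p>2) 0) r)
  , largeBlocks
  where
  module Block = VanDerPutBlock p (ℕ.nonTrivial⇒n>1 p {{prime⇒nonTrivial pr}}) f lip mp
  largeBlocks : (n : ℕ) → n ≥ 3 → (r : ℤ) → CongruenceChain p f n r
  largeBlocks (suc (suc (suc k))) _ = Block.congruenceChain (suc (suc k)) (N*G≡0 pr k)
  largeBlocks (suc (suc zero)) (s≤s (s≤s ()))
  largeBlocks (suc zero) (s≤s ())
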